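{- Let $\chi$ be a skew shape, $T\in\mathrm{Tab}(\chi)$, and let $\bar T\in\mathrm{Tab}(\nu/\kappa)$ be a companion tableau of $T$. Let $\bar T'\in\mathrm{Tab}(\nu'/\kappa')$ be obtained from $\bar T$ by an inward jeu de taquin slide into a square in row $k$, the slide ending (i.e. the vacated square being) in row $l$. Then the sequence $T=T_k,T_{k+1},\dots,T_l\in\mathrm{Tab}(\chi)$ given by $T_{i+1}=e_i(T_i)$ for $k\le i<l$ is well defined, and $\bar T'$ is a companion tableau of $T_l$; moreover $T_l$ is the first tableau in this sequence that is $\kappa'$-dominant.
   Context: For partitions $\mu\subseteq\lambda$, the skew shape $\lambda/\mu$ has diagram $Y(\lambda/\mu)=\{(i,j):\mu_i\le j<\lambda_i\}$ (row $i$ from $0$ at the top, column $j$ from the left); $\mathrm{Tab}(\lambda/\mu)$ is the set of semistandard tableaux of this shape with entries in $\mathbb{N}$ (weakly increasing along rows, strictly increasing down columns). The weight $\mathrm{wt}\,T$ has $i$-th component the number of entries equal to $i$. $\kappa$-dominance: for a partition $\kappa$, $T$ is $\kappa$-dominant if, reading its entries in Semitic order (rows top to bottom, each row right to left), starting with $\alpha=\kappa$ and increasing $\alpha_i$ by $1$ for each entry $i$ read, $\alpha$ is a partition at every stage. Companion tableau: for $T\in\mathrm{Tab}(\chi)$ and partitions $\kappa\subseteq\nu$, a tableau $\bar T\in\mathrm{Tab}(\nu/\kappa)$ is a companion tableau of $T$ if for all $i,r\in\mathbb{N}$ the number of entries $r$ in row $i$ of $\bar T$ equals the number of entries $i$ in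 row $r$ of $T$ (rows of $T$ being numbered in the diagram of $\chi$). Inward jeu de taquin slide of $\bar T$ (shape $\nu/\kappa$) into a square $s\in Y(\kappa)$ with $Y(\kappa)\setminus\{s\}$ a partition diagram: regard $s$ as empty; repeatedly, if the empty square has a tableau square to its right or below, the smaller of these entries moves into the empty square (the one below in case of equality); when there is neither, stop and delete the empty square. The result has shape $\nu'/\kappa'$ with $\kappa'=\kappa$ minus $s$ and $\nu'=\nu$ minus the final vacated square. Raising operations: for a word $w$ over $\mathbb{N}$, $w$ is dominant for $i$ if every prefix has at least as many letters $i$ as $i+1$, anti-dominant for $i$ if every suffix has at least as many letters $i+1$ as $i$; if $w=u\,(i+1)\,v$ with $u$ anti-dominant and $v$ dominant for $i$, then $e_i(w)=u\,i\,v$. For a tableau $T$, $e_i(T)$ is defined iff $e_i$ is defined on the word of entries of $T$ read in Semitic order, and is obtained by decreasing by $1$ the entry of $T$ corresponding to the changed letter (the result is semistandard, and the same for any reading order $\le_r$ with $(i,j)\le_r(i',j')$ whenever $i\le i'$, $j\ge j'$). -}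

module Defs where

open import Data.Nat using (ℕ; zero; suc; _+_; _∸_; _≤_; _<_; _≤ᵇ_; _≡ᵇ_)
open import Data.Bool using (Bool; true; false; if_then_else_)
open import Data.List using (List; []; _∷_; _++_; length; map; concatMap; reverse)
open import Data.Maybe using (Maybe; just; nothing)
open import Data.Product using (Σ; _×_; _,_; ∃)
open import Data.Sum using (_⊎_)
open import Relation.Binary.PropositionalEquality using (_≡_)
open import Relation.Nullary using (¬_)

nth : {A : Set} → List A → ℕ → Maybe A
nth []       _       = nothing
nth (x ∷ xs) zero    = just x
nth (x ∷ xs) (suc i) = nth xs i

nthD : {A : Set} → A → List A → ℕ → A
nthD d []       _       = d
nthD d (x ∷ xs) zero    = x
nthD d (x ∷ xs) (suc i) = nthD d xs i

count : ℕ → List ℕ → ℕ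
count x []       = 0
count x (y ∷ ys) = if x ≡ᵇ y then suc (count x ys) else count x ys

-- Partitions: a finite list of parts, padded by zeros.
-- part κ i = κ_i (0 beyond the list)

part : List ℕ → ℕ → ℕ
part = nthD 0

IsPartition : List ℕ → Set
IsPartition κ = ∀ i → part κ (suc i) ≤ part κ i

_⊆ₚ_ : List ℕ → List ℕ → Set
μ ⊆ₚ λ' = ∀ i → part μ i ≤ part λ' i

-- Tableaux of a skew shape λ/μ are stored as a list of rows; row i
-- (from 0 at the top) lists the entries of the squares (i,j),
-- μ_i ≤ j < λ_i, from left to right.

Tableau : Set
Tableau = List (List ℕ)

row : Tableau → ℕ → List ℕ
row = nthD []

Grid : Set
Grid = ℕ → ℕ → Maybe ℕ

grid : List ℕ → Tableau → Grid
grid μ T i j = if suc j ≤ᵇ part μ i then nothing else nth (row T i) (j ∸ part μ i)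

Tab : List ℕ → List ℕ → Tableau → Set
Tab λ' μ T =
    (∀ i → length (row T i) ≡ part λ' i ∸ part μ i)
  × (∀ i j x y → grid μ T i j ≡ just x → grid μ T i (suc j) ≡ just y → x ≤ y)
  × (∀ i j x y → grid μ T i j ≡ just x → grid μ T (suc i) j ≡ just y → x < y)

SkewShape : List ℕ → List ℕ → Set
SkewShape λ' μ = IsPartition λ' × IsPartition μ × μ ⊆ₚ λ'

semitic : Tableau → List ℕ
semitic = concatMap reverse

alpha : List ℕ → List ℕ → ℕ → ℕ
alpha κ u j = part κ j + count j u

KappaDominant : List ℕ → Tableau → Set
KappaDominant κ T = ∀ u v → semitic T ≡ u ++ v → ∀ j → alpha κ u (suc j) ≤ alpha κ u j

Companion : Tableau → Tableau → Set
Companion T T̄ = ∀ i r → count r (row T̄ i) ≡ count i (row T r)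

DominantFor : ℕ → List ℕ → Set
DominantFor i w = ∀ u v → w ≡ u ++ v → count (suc i) u ≤ count i u

AntiDominantFor : ℕ → List ℕ → Set
AntiDominantFor i w = ∀ u v → w ≡ u ++ v → count i v ≤ count (suc i) v

-- RaiseWord i w w'  :  e_i(w) is defined and equals w'
RaiseWord : ℕ → List ℕ → List ℕ → Set
RaiseWord i w w' = Σ (List ℕ) λ u → Σ (List ℕ) λ v →
    (w ≡ u ++ suc i ∷ v) × AntiDominantFor i u × DominantFor i v × (w' ≡ u ++ i ∷ v)

-- RaiseTab i T T'  :  e_i(T) is defined and equals T'
-- (same row lengths, and the Semitic word is changed by e_i; so exactly
--  the entry corresponding to the changed letter is decreased by 1)
RaiseTab : ℕ → Tableau → Tableau → Set
RaiseTab i T T' = (map length T ≡ map length T') × RaiseWord i (semitic T) (semitic T')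

-- Chain i l T U : U = T_l where T_i = T and T_{m+1} = e_m(T_m), i ≤ m < l
data Chain : ℕ → ℕ → Tableau → Tableau → Set where
  done : ∀ {i T} → Chain i i T T
  step : ∀ {i l T T' U} → RaiseTab i T T' → Chain (suc i) l T' U → Chain i l T U

upd : Grid → ℕ → ℕ → Maybe ℕ → Grid
upd G a b m i j = if (i ≡ᵇ a) Data.Bool.∧ (j ≡ᵇ b) then m else G i j

move : Grid → ℕ → ℕ → ℕ → ℕ → ℕ → Grid
move G a b a' b' x = upd (upd G a b (just x)) a' b' nothing

-- Slide G a b G' l c : with (a,b) the empty square of G, the slide
-- terminates after deleting the empty square (l,c), with a final grid
-- pointwise equal to G'.
data Slide : Grid → ℕ → ℕ → Grid → ℕ → ℕ → Set where
  stop  : ∀ {G a b G'} → G a (suc b) ≡ nothing → G (suc a) b ≡ nothing →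
          (∀ i j → G' i j ≡ G i j) →
          Slide G a b G' a b
  right : ∀ {G a b G' l c x} → G a (suc b) ≡ just x →
          (G (suc a) b ≡ nothing ⊎ Σ ℕ (λ y → G (suc a) b ≡ just y × x < y)) →
          Slide (move G a b a (suc b) x) a (suc b) G' l c →
          Slide G a b G' l c
  down  : ∀ {G a b G' l c y} → G (suc a) b ≡ just y →
          (G a (suc b) ≡ nothing ⊎ Σ ℕ (λ x → G a (suc b) ≡ just x × y ≤ x)) →
          Slide (move G a b (suc a) b y) (suc a) b G' l c →
          Slide G a b G' l c

-- Follow the slide on the companion tableau.  A move to the right keeps the entries of every row
-- of the grid, so the companion does not change.  A move down, carrying the entry v from row a + 1
-- into row a, turns one letter a + 1 of row v of the companion into a.  Comparing rows a and a + 1 of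
-- the grid column by column shows that, for the leftmost a + 1 of row v, the letters a and a + 1 of
-- the Semitic word around it satisfy the (anti-)dominance conditions that make this change e_a, that
-- the result is again semistandard, and that the tableau before it was not κ'-dominant.  When the
-- slide stops the grid is T̄' of shape ν'/κ', and its column strictness becomes κ'-dominance of the
-- companion.

module Submission where

open import Defs
open import Data.Bool using (true; false; if_then_else_; T)
open import Data.Empty using (⊥; ⊥-elim)
open import Data.List using (List; []; _∷_; _++_; length; map; reverse)
open import Data.List.Properties
  using (++-assoc; ++-identityʳ; ∷-injective; length-++; length-reverse; map-++; concatMap-++; reverse-++; reverse-injective; unfold-reverse)
open import Data.List.Relation.Unary.All as All using (All; []; _∷_)
open import Data.List.Relation.Unary.All.Properties using (++⁻ʳ)
open import Data.Maybe using (Maybe; just; nothing)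
open import Data.Maybe.Properties using (just-injective)
open import Data.Nat using (ℕ; zero; suc; _+_; _∸_; _≤_; _<_; _≤ᵇ_; _≡ᵇ_; z≤n; s≤s)
open import Data.Nat.Properties
open import Data.Nat.Tactic.RingSolver using (solve-∀)
open import Data.Product using (Σ; _×_; _,_; proj₁; proj₂)
open import Data.Sum using (_⊎_; inj₁; inj₂)
open import Data.Unit using (tt)
open import Function using (_∘_)
open import Relation.Binary.Definitions using (tri<; tri≈; tri>)
open import Relation.Binary.PropositionalEquality
open import Relation.Nullary using (¬_; yes; no)

Σ< : (ℕ → ℕ) → ℕ → ℕ
Σ< f zero    = 0
Σ< f (suc n) = f zero + Σ< (λ j → f (suc j)) n

Σ<-cong : ∀ {f g} n → (∀ j → j < n → f j ≡ g j) → Σ< f n ≡ Σ< g n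
Σ<-cong zero    h = refl
Σ<-cong (suc n) h = cong₂ _+_ (h 0 (s≤s z≤n)) (Σ<-cong n (λ j p → h (suc j) (s≤s p)))

Σ<-mono-≤ : ∀ {f g} n → (∀ j → j < n → f j ≤ g j) → Σ< f n ≤ Σ< g n
Σ<-mono-≤ zero    h = z≤n
Σ<-mono-≤ (suc n) h = +-mono-≤ (h 0 (s≤s z≤n)) (Σ<-mono-≤ n (λ j p → h (suc j) (s≤s p)))

Σ<-mono-< : ∀ {f g} n p → (∀ j → j < n → f j ≤ g j) → p < n → f p < g p → Σ< f n < Σ< g n
Σ<-mono-< (suc n) zero    h _ q = +-mono-<-≤ q (Σ<-mono-≤ n (λ j r → h (suc j) (s≤s r)))
Σ<-mono-< (suc n) (suc p) h (s≤s p<n) q =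
  +-mono-≤-< (h 0 (s≤s z≤n)) (Σ<-mono-< n p (λ j r → h (suc j) (s≤s r)) p<n q)

Σ<-zero : ∀ {f} n → (∀ j → j < n → f j ≡ 0) → Σ< f n ≡ 0
Σ<-zero zero    h = refl
Σ<-zero (suc n) h rewrite h 0 (s≤s z≤n) = Σ<-zero n (λ j p → h (suc j) (s≤s p))

Σ<-term-≤ : ∀ f n p → p < n → f p ≤ Σ< f n
Σ<-term-≤ f (suc n) zero    _       = m≤m+n _ _
Σ<-term-≤ f (suc n) (suc p) (s≤s q) = ≤-trans (Σ<-term-≤ (λ j → f (suc j)) n p q) (m≤n+m _ _)

Σ<-+ : ∀ f g n → Σ< (λ j → f j + g j) n ≡ Σ< f n + Σ< g n
Σ<-+ f g zero = refl
Σ<-+ f g (suc n) rewrite Σ<-+ (λ j → f (suc j)) (λ j → g (suc j)) n =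
  interchange (f 0) (g 0) (Σ< (λ j → f (suc j)) n) (Σ< (λ j → g (suc j)) n)
  where interchange : ∀ a b c d → a + b + (c + d) ≡ a + c + (b + d)
        interchange = solve-∀

Σ<-split : ∀ f m n → Σ< f (m + n) ≡ Σ< f m + Σ< (λ j → f (m + j)) n
Σ<-split f zero    n = refl
Σ<-split f (suc m) n rewrite Σ<-split (λ j → f (suc j)) m n = sym (+-assoc (f 0) _ _)

Σ<-last : ∀ f n → Σ< f (suc n) ≡ Σ< f n + f n
Σ<-last f n = begin
  Σ< f (suc n)                        ≡⟨ cong (Σ< f) (+-comm 1 n) ⟩
  Σ< f (n + 1)                        ≡⟨ Σ<-split f n 1 ⟩
  Σ< f n + (f (n + 0) + 0)            ≡⟨ cong (λ t → Σ< f n + (f t + 0)) (+-identityʳ n) ⟩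
  Σ< f n + (f n + 0)                  ≡⟨ cong (Σ< f n +_) (+-identityʳ (f n)) ⟩
  Σ< f n + f n                        ∎
  where open ≡-Reasoning

Σ<-tail-zero : ∀ f n m → n ≤ m → (∀ j → n ≤ j → j < m → f j ≡ 0) → Σ< f m ≡ Σ< f n
Σ<-tail-zero f n m n≤m h = begin
  Σ< f m                                   ≡⟨ cong (Σ< f) (sym (m+[n∸m]≡n n≤m)) ⟩
  Σ< f (n + (m ∸ n))                       ≡⟨ Σ<-split f n (m ∸ n) ⟩
  Σ< f n + Σ< (λ j → f (n + j)) (m ∸ n)    ≡⟨ cong (Σ< f n +_) (Σ<-zero (m ∸ n) tail) ⟩
  Σ< f n + 0                               ≡⟨ +-identityʳ _ ⟩
  Σ< f n                                   ∎
  where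
    open ≡-Reasoning
    tail : ∀ j → j < m ∸ n → f (n + j) ≡ 0
    tail j p = h (n + j) (m≤m+n n j) (subst (n + j <_) (m+[n∸m]≡n n≤m) (+-monoʳ-< n p))

Σ<-swap : ∀ (F : ℕ → ℕ → ℕ) m n → Σ< (λ s → Σ< (F s) n) m ≡ Σ< (λ j → Σ< (λ s → F s j) m) n
Σ<-swap F zero    n = sym (Σ<-zero n (λ _ _ → refl))
Σ<-swap F (suc m) n rewrite Σ<-swap (λ s → F (suc s)) m n =
  sym (Σ<-+ (F 0) (λ j → Σ< (λ s → F (suc s) j) m) n)

Σ<-update : ∀ f g n p → p < n → (∀ j → ¬ j ≡ p → g j ≡ f j) → Σ< g n + f p ≡ Σ< f n + g p
Σ<-update f g (suc n) zero _ h
  rewrite Σ<-cong {λ j → g (suc j)} {λ j → f (suc j)} n (λ j _ → h (suc j) (λ ()))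
  = swap₁₃ (g 0) (f 0) (Σ< (λ j → f (suc j)) n)
  where swap₁₃ : ∀ a b c → a + c + b ≡ b + c + a
        swap₁₃ = solve-∀
Σ<-update f g (suc n) (suc p) (s≤s p<n) h rewrite h 0 (λ ()) = begin
  f 0 + Σ< g′ n + f (suc p)    ≡⟨ +-assoc (f 0) _ _ ⟩
  f 0 + (Σ< g′ n + f (suc p))  ≡⟨ cong (f 0 +_) (Σ<-update f′ g′ n p p<n (λ j q → h (suc j) (q ∘ suc-injective))) ⟩
  f 0 + (Σ< f′ n + g (suc p))  ≡⟨ sym (+-assoc (f 0) _ _) ⟩
  f 0 + Σ< f′ n + g (suc p)    ∎
  where
    open ≡-Reasoning
    f′ g′ : ℕ → ℕ
    f′ j = f (suc j)
    g′ j = g (suc j)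

T⇒≡true : ∀ {b} → T b → b ≡ true
T⇒≡true {true} _ = refl

¬T⇒≡false : ∀ {b} → ¬ T b → b ≡ false
¬T⇒≡false {true}  h = ⊥-elim (h tt)
¬T⇒≡false {false} _ = refl

occ : ℕ → Maybe ℕ → ℕ
occ r nothing  = 0
occ r (just x) = if r ≡ᵇ x then 1 else 0

occBelow : ℕ → Maybe ℕ → ℕ
occBelow r nothing  = 0
occBelow r (just x) = if suc x ≤ᵇ r then 1 else 0

occ-self : ∀ r → occ r (just r) ≡ 1
occ-self r rewrite T⇒≡true (≡⇒≡ᵇ r r refl) = refl

occ-≢ : ∀ {r x} → ¬ r ≡ x → occ r (just x) ≡ 0
occ-≢ {r} {x} r≢x rewrite ¬T⇒≡false (r≢x ∘ ≡ᵇ⇒≡ r x) = refl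

occBelow-< : ∀ {r x} → x < r → occBelow r (just x) ≡ 1
occBelow-< x<r rewrite T⇒≡true (≤⇒≤ᵇ x<r) = refl

occBelow-≥ : ∀ {r x} → r ≤ x → occBelow r (just x) ≡ 0
occBelow-≥ {r} {x} r≤x rewrite ¬T⇒≡false (λ t → <⇒≱ (≤ᵇ⇒≤ (suc x) r t) r≤x) = refl

occBelow-≤1 : ∀ r m → occBelow r m ≤ 1
occBelow-≤1 r nothing = z≤n
occBelow-≤1 r (just x) with x <? r
... | yes x<r rewrite occBelow-< x<r = ≤-refl
... | no x≮r rewrite occBelow-≥ {r} {x} (≮⇒≥ x≮r) = z≤n

occBelow-pos : ∀ {r x} m → m ≡ just x → x < r → 1 ≤ occBelow r m
occBelow-pos _ refl x<r rewrite occBelow-< x<r = ≤-refl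

occBelow-none : ∀ {r} m → (∀ x → m ≡ just x → r ≤ x) → occBelow r m ≡ 0
occBelow-none nothing  _ = refl
occBelow-none (just x) h = occBelow-≥ (h x refl)

occBelow-monoˡ : ∀ {r r'} m → r ≤ r' → occBelow r m ≤ occBelow r' m
occBelow-monoˡ nothing _ = z≤n
occBelow-monoˡ {r} {r'} (just x) r≤r' with x <? r
... | yes x<r rewrite occBelow-< x<r | occBelow-< {r'} {x} (<-≤-trans x<r r≤r') = ≤-refl
... | no x≮r rewrite occBelow-≥ {r} {x} (≮⇒≥ x≮r) = z≤n

occBelow-transfer : ∀ {r r' x x'} → (x < r → x' < r') → occBelow r (just x) ≤ occBelow r' (just x')
occBelow-transfer {r} {r'} {x} {x'} h with x <? r
... | yes x<r rewrite occBelow-< x<r | occBelow-< {r'} {x'} (h x<r) = ≤-refl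
... | no x≮r rewrite occBelow-≥ {r} {x} (≮⇒≥ x≮r) = z≤n

Σ<-occ : ∀ m r → Σ< (λ s → occ s m) r ≡ occBelow r m
Σ<-occ nothing  r    = Σ<-zero r (λ _ _ → refl)
Σ<-occ (just x) zero = refl
Σ<-occ (just x) (suc r) rewrite Σ<-last (λ s → occ s (just x)) r | Σ<-occ (just x) r with <-cmp x r
... | tri< x<r x≢r _ rewrite occBelow-< x<r | occBelow-< {suc r} (m<n⇒m<1+n x<r) | occ-≢ (x≢r ∘ sym) = refl
... | tri≈ _ refl _ rewrite occBelow-≥ {x} {x} ≤-refl | occBelow-< {suc x} {x} ≤-refl | occ-self x = refl
... | tri> _ x≢r r<x rewrite occBelow-≥ {r} {x} (<⇒≤ r<x) | occBelow-≥ {suc r} {x} r<x | occ-≢ (x≢r ∘ sym) = refl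

Σ<-occBelow-index : ∀ k H → k ≤ H → Σ< (λ j → occBelow k (just j)) H ≡ k
Σ<-occBelow-index zero    H       _         = Σ<-zero H (λ _ _ → refl)
Σ<-occBelow-index (suc k) (suc H) (s≤s k≤H) = cong suc (Σ<-occBelow-index k H k≤H)

count-cons : ∀ r y ys → count r (y ∷ ys) ≡ occ r (just y) + count r ys
count-cons r y ys with r ≡ᵇ y
... | true  = refl
... | false = refl

count-++ : ∀ r xs ys → count r (xs ++ ys) ≡ count r xs + count r ys
count-++ r []       ys = refl
count-++ r (x ∷ xs) ys rewrite count-cons r x (xs ++ ys) | count-cons r x xs | count-++ r xs ys =
  sym (+-assoc (occ r (just x)) _ _)

count-++-≤ˡ : ∀ r xs ys → count r xs ≤ count r (xs ++ ys)
count-++-≤ˡ r xs ys rewrite count-++ r xs ys = m≤m+n _ _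

count-++-≤ʳ : ∀ r xs ys → count r ys ≤ count r (xs ++ ys)
count-++-≤ʳ r xs ys rewrite count-++ r xs ys = m≤n+m _ _

count-singleton : ∀ r x → count r (x ∷ []) ≡ occ r (just x)
count-singleton r x = trans (count-cons r x []) (+-identityʳ _)

count-reverse : ∀ r xs → count r (reverse xs) ≡ count r xs
count-reverse r []       = refl
count-reverse r (x ∷ xs) = begin
  count r (reverse (x ∷ xs))               ≡⟨ cong (count r) (unfold-reverse x xs) ⟩
  count r (reverse xs ++ x ∷ [])           ≡⟨ count-++ r (reverse xs) (x ∷ []) ⟩
  count r (reverse xs) + count r (x ∷ [])  ≡⟨ cong₂ _+_ (count-reverse r xs) (count-singleton r x) ⟩
  count r xs + occ r (just x)              ≡⟨ +-comm (count r xs) _ ⟩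
  occ r (just x) + count r xs              ≡⟨ sym (count-cons r x xs) ⟩
  count r (x ∷ xs)                         ∎
  where open ≡-Reasoning

count-All-≢ : ∀ {P : ℕ → Set} {r} xs → All P xs → (∀ z → P z → ¬ r ≡ z) → count r xs ≡ 0
count-All-≢ []       _          _ = refl
count-All-≢ {r = r} (y ∷ ys) (py ∷ pys) h rewrite count-cons r y ys | occ-≢ (h y py) = count-All-≢ ys pys h

count-pos⇒nonempty : ∀ r xs → 0 < count r xs → 0 < length xs
count-pos⇒nonempty r (y ∷ xs) _ = s≤s z≤n

nth-out : ∀ {A : Set} (xs : List A) p → length xs ≤ p → nth xs p ≡ nothing
nth-out []       p       _       = refl
nth-out (x ∷ xs) (suc p) (s≤s q) = nth-out xs p q

nth-in : ∀ {A : Set} (xs : List A) p → p < length xs → Σ A (λ x → nth xs p ≡ just x)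
nth-in (x ∷ xs) zero    _       = x , refl
nth-in (x ∷ xs) (suc p) (s≤s q) = nth-in xs p q

nth-++ˡ : ∀ {A : Set} (xs ys : List A) p → p < length xs → nth (xs ++ ys) p ≡ nth xs p
nth-++ˡ (x ∷ xs) ys zero    _       = refl
nth-++ˡ (x ∷ xs) ys (suc p) (s≤s q) = nth-++ˡ xs ys p q

nth-++ʳ : ∀ {A : Set} (xs ys : List A) q → nth (xs ++ ys) (length xs + q) ≡ nth ys q
nth-++ʳ []       ys q = refl
nth-++ʳ (x ∷ xs) ys q = nth-++ʳ xs ys q

nth-middle : ∀ {A : Set} (xs ys : List A) z → nth (xs ++ z ∷ ys) (length xs) ≡ just z
nth-middle xs ys z = trans (cong (nth (xs ++ z ∷ ys)) (sym (+-identityʳ (length xs)))) (nth-++ʳ xs (z ∷ ys) 0)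

nth-middle-≢ : ∀ {A : Set} (xs ys : List A) z z' p → ¬ p ≡ length xs →
               nth (xs ++ z ∷ ys) p ≡ nth (xs ++ z' ∷ ys) p
nth-middle-≢ xs ys z z' p p≢ with <-cmp p (length xs)
... | tri< p< _ _ = trans (nth-++ˡ xs _ p p<) (sym (nth-++ˡ xs _ p p<))
... | tri≈ _ p≡ _ = ⊥-elim (p≢ p≡)
... | tri> _ _ p> = begin
  nth (xs ++ z ∷ ys) p                    ≡⟨ cong (nth (xs ++ z ∷ ys)) (sym p≡) ⟩
  nth (xs ++ z ∷ ys) (length xs + suc d)  ≡⟨ nth-++ʳ xs (z ∷ ys) (suc d) ⟩
  nth ys d                                ≡⟨ sym (nth-++ʳ xs (z' ∷ ys) (suc d)) ⟩
  nth (xs ++ z' ∷ ys) (length xs + suc d) ≡⟨ cong (nth (xs ++ z' ∷ ys)) p≡ ⟩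
  nth (xs ++ z' ∷ ys) p                   ∎
  where
    open ≡-Reasoning
    d = p ∸ suc (length xs)
    p≡ : length xs + suc d ≡ p
    p≡ = trans (+-suc (length xs) d) (m+[n∸m]≡n p>)

nth-All : ∀ {A : Set} {P : A → Set} xs p {x} → All P xs → nth xs p ≡ just x → P x
nth-All (y ∷ ys) zero    (py ∷ _)   refl = py
nth-All (y ∷ ys) (suc p) (_  ∷ pys) e    = nth-All ys p pys e

Σ<-occ-nth : ∀ r xs n → length xs ≤ n → Σ< (λ p → occ r (nth xs p)) n ≡ count r xs
Σ<-occ-nth r []       n       _       = Σ<-zero n (λ _ _ → refl)
Σ<-occ-nth r (x ∷ xs) (suc n) (s≤s q) rewrite count-cons r x xs = cong (occ r (just x) +_) (Σ<-occ-nth r xs n q)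

nothing≢just : ∀ {A : Set} {x : A} → nothing ≢ just x
nothing≢just ()

rowGrid : ℕ → List ℕ → ℕ → Maybe ℕ
rowGrid o xs j = if suc j ≤ᵇ o then nothing else nth xs (j ∸ o)

rowGrid-below : ∀ o xs j → j < o → rowGrid o xs j ≡ nothing
rowGrid-below o xs j j<o rewrite T⇒≡true (≤⇒≤ᵇ j<o) = refl

rowGrid-above : ∀ o xs j → o ≤ j → rowGrid o xs j ≡ nth xs (j ∸ o)
rowGrid-above o xs j o≤j rewrite ¬T⇒≡false (λ t → <⇒≱ (≤ᵇ⇒≤ (suc j) o t) o≤j) = refl

rowGrid-offset : ∀ o xs p → rowGrid o xs (o + p) ≡ nth xs p
rowGrid-offset o xs p = trans (rowGrid-above o xs (o + p) (m≤m+n o p)) (cong (nth xs) (m+n∸m≡n o p))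

rowGrid-beyond : ∀ o xs j → o + length xs ≤ j → rowGrid o xs j ≡ nothing
rowGrid-beyond o xs j end≤j with j <? o
... | yes j<o = rowGrid-below o xs j j<o
... | no j≮o rewrite rowGrid-above o xs j (≮⇒≥ j≮o) =
  nth-out xs (j ∸ o) (subst (_≤ j ∸ o) (m+n∸m≡n o (length xs)) (∸-monoˡ-≤ o end≤j))

rowGrid-filled : ∀ o xs j → o ≤ j → j < o + length xs → Σ ℕ (λ x → rowGrid o xs j ≡ just x)
rowGrid-filled o xs j o≤j j<end rewrite rowGrid-above o xs j o≤j =
  nth-in xs (j ∸ o) (subst (j ∸ o <_) (m+n∸m≡n o (length xs)) (∸-monoˡ-< j<end o≤j))

rowGrid-bounds : ∀ o xs j {x} → rowGrid o xs j ≡ just x → o ≤ j × j < o + length xs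
rowGrid-bounds o xs j e with j <? o | o + length xs ≤? j
... | yes j<o | _          = ⊥-elim (nothing≢just (trans (sym (rowGrid-below o xs j j<o)) e))
... | no j≮o  | yes end≤j = ⊥-elim (nothing≢just (trans (sym (rowGrid-beyond o xs j end≤j)) e))
... | no j≮o  | no end≰j  = ≮⇒≥ j≮o , ≰⇒> end≰j

Σ<-occ-rowGrid : ∀ r o xs H → o + length xs ≤ H → Σ< (λ j → occ r (rowGrid o xs j)) H ≡ count r xs
Σ<-occ-rowGrid r o xs H end≤H = begin
  Σ< f H                                ≡⟨ cong (Σ< f) (sym (m+[n∸m]≡n o≤H)) ⟩
  Σ< f (o + (H ∸ o))                    ≡⟨ Σ<-split f o (H ∸ o) ⟩
  Σ< f o + Σ< (λ j → f (o + j)) (H ∸ o) ≡⟨ cong₂ _+_ (Σ<-zero o (λ j j<o → cong (occ r) (rowGrid-below o xs j j<o)))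
                                                    (Σ<-cong (H ∸ o) (λ j _ → cong (occ r) (rowGrid-offset o xs j))) ⟩
  Σ< (λ p → occ r (nth xs p)) (H ∸ o)   ≡⟨ Σ<-occ-nth r xs (H ∸ o) (subst (_≤ H ∸ o) (m+n∸m≡n o (length xs)) (∸-monoˡ-≤ o end≤H)) ⟩
  count r xs                            ∎
  where
    open ≡-Reasoning
    f = λ j → occ r (rowGrid o xs j)
    o≤H = ≤-trans (m≤m+n o (length xs)) end≤H

rowGrid-sorted : ∀ o xs → (∀ j x x' → rowGrid o xs j ≡ just x → rowGrid o xs (suc j) ≡ just x' → x ≤ x') →
                 ∀ j j' x x' → j ≤ j' → rowGrid o xs j ≡ just x → rowGrid o xs j' ≡ just x' → x ≤ x'
rowGrid-sorted o xs adj j j' x x' j≤j' e e' = go (j' ∸ j) j x (trans (cong (rowGrid o xs) (m∸n+n≡m j≤j')) e') e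
  where
    go : ∀ d j x → rowGrid o xs (d + j) ≡ just x' → rowGrid o xs j ≡ just x → x ≤ x'
    go zero    j x e' e = ≤-reflexive (just-injective (trans (sym e) e'))
    go (suc d) j x e' e with rowGrid-filled o xs (suc j) (≤-trans (proj₁ (rowGrid-bounds o xs j e)) (n≤1+n j))
                               (≤-<-trans (s≤s (m≤n+m j d)) (proj₂ (rowGrid-bounds o xs (suc d + j) e')))
    ... | z , ez = ≤-trans (adj j x z e ez) (go d (suc j) z (trans (cong (rowGrid o xs) (+-suc d j)) e') ez)

-- Rows and the Semitic reading word

++-split : ∀ {A : Set} (u₁ u₂ p q : List A) → u₁ ++ u₂ ≡ p ++ q →
  (Σ (List A) λ m → p ≡ u₁ ++ m × u₂ ≡ m ++ q) ⊎ (Σ (List A) λ m → u₁ ≡ p ++ m × q ≡ m ++ u₂)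
++-split []       u₂ p       q eq = inj₁ (p , refl , eq)
++-split (x ∷ u₁) u₂ []      q eq = inj₂ (x ∷ u₁ , refl , sym eq)
++-split (x ∷ u₁) u₂ (y ∷ p) q eq with ∷-injective eq
... | refl , eq' with ++-split u₁ u₂ p q eq'
... | inj₁ (m , e₁ , e₂) = inj₁ (m , cong (x ∷_) e₁ , e₂)
... | inj₂ (m , e₁ , e₂) = inj₂ (m , cong (x ∷_) e₁ , e₂)

++-injective-length : ∀ {A : Set} (p q r s : List A) → length p ≡ length q → p ++ r ≡ q ++ s → p ≡ q × r ≡ s
++-injective-length []      []      r s _ e = refl , e
++-injective-length (x ∷ p) (y ∷ q) r s l e with ∷-injective e
... | refl , e' with ++-injective-length p q r s (suc-injective l) e'
... | refl , e'' = refl , e''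

row-++ˡ : ∀ (Xs Ys : Tableau) s → s < length Xs → row (Xs ++ Ys) s ≡ row Xs s
row-++ˡ (X ∷ Xs) Ys zero    _       = refl
row-++ˡ (X ∷ Xs) Ys (suc s) (s≤s p) = row-++ˡ Xs Ys s p

row-++ʳ : ∀ (Xs Ys : Tableau) n → row (Xs ++ Ys) (length Xs + n) ≡ row Ys n
row-++ʳ []       Ys n = refl
row-++ʳ (X ∷ Xs) Ys n = row-++ʳ Xs Ys n

row-middle : ∀ (Xs Ys : Tableau) Z → row (Xs ++ Z ∷ Ys) (length Xs) ≡ Z
row-middle Xs Ys Z = trans (cong (row (Xs ++ Z ∷ Ys)) (sym (+-identityʳ (length Xs)))) (row-++ʳ Xs (Z ∷ Ys) 0)

row-middle-≢ : ∀ (Xs Ys : Tableau) Z Z' s → ¬ s ≡ length Xs → row (Xs ++ Z ∷ Ys) s ≡ row (Xs ++ Z' ∷ Ys) s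
row-middle-≢ Xs Ys Z Z' s s≢ with <-cmp s (length Xs)
... | tri< s< _ _ = trans (row-++ˡ Xs _ s s<) (sym (row-++ˡ Xs _ s s<))
... | tri≈ _ s≡ _ = ⊥-elim (s≢ s≡)
... | tri> _ _ s> = begin
  row (Xs ++ Z ∷ Ys) s                    ≡⟨ cong (row (Xs ++ Z ∷ Ys)) (sym s≡) ⟩
  row (Xs ++ Z ∷ Ys) (length Xs + suc d)  ≡⟨ row-++ʳ Xs (Z ∷ Ys) (suc d) ⟩
  row Ys d                                ≡⟨ sym (row-++ʳ Xs (Z' ∷ Ys) (suc d)) ⟩
  row (Xs ++ Z' ∷ Ys) (length Xs + suc d) ≡⟨ cong (row (Xs ++ Z' ∷ Ys)) s≡ ⟩
  row (Xs ++ Z' ∷ Ys) s                   ∎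
  where
    open ≡-Reasoning
    d = s ∸ suc (length Xs)
    s≡ : length Xs + suc d ≡ s
    s≡ = trans (+-suc (length Xs) d) (m+[n∸m]≡n s>)

row-beyond : ∀ (Xs : Tableau) s → length Xs ≤ s → row Xs s ≡ []
row-beyond []       s       _       = refl
row-beyond (X ∷ Xs) (suc s) (s≤s p) = row-beyond Xs s p

nonempty-row⇒< : ∀ (Ts : Tableau) y → 0 < length (row Ts y) → y < length Ts
nonempty-row⇒< (R ∷ Ts) zero    _ = s≤s z≤n
nonempty-row⇒< (R ∷ Ts) (suc y) p = s≤s (nonempty-row⇒< Ts y p)

split-at-row : ∀ (Ts : Tableau) y → y < length Ts →
               Σ Tableau λ Top → Σ Tableau λ Bot → Ts ≡ Top ++ row Ts y ∷ Bot × length Top ≡ y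
split-at-row (R ∷ Ts) zero    _       = [] , Ts , refl , refl
split-at-row (R ∷ Ts) (suc y) (s≤s p) with split-at-row Ts y p
... | Top , Bot , e , l = R ∷ Top , Bot , cong (R ∷_) e , cong suc l

countAbove : Tableau → ℕ → ℕ → ℕ
countAbove Ts x n = Σ< (λ s → count x (row Ts s)) n

countAbove-++ˡ : ∀ Xs Ys x r → r ≤ length Xs → countAbove (Xs ++ Ys) x r ≡ countAbove Xs x r
countAbove-++ˡ Xs Ys x r p = Σ<-cong r (λ j q → cong (count x) (row-++ˡ Xs Ys j (<-≤-trans q p)))

countAbove-++ʳ : ∀ Xs Ys x n → countAbove (Xs ++ Ys) x (length Xs + n) ≡ countAbove Xs x (length Xs) + countAbove Ys x n
countAbove-++ʳ Xs Ys x n = trans (Σ<-split _ (length Xs) n)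
  (cong₂ _+_ (countAbove-++ˡ Xs Ys x (length Xs) ≤-refl) (Σ<-cong n (λ j _ → cong (count x) (row-++ʳ Xs Ys j))))

countAbove-saturated : ∀ Xs x r → length Xs ≤ r → countAbove Xs x r ≡ countAbove Xs x (length Xs)
countAbove-saturated Xs x r p = Σ<-tail-zero _ (length Xs) r p (λ j q _ → cong (count x) (row-beyond Xs j q))

count-semitic : ∀ x Rs → count x (semitic Rs) ≡ countAbove Rs x (length Rs)
count-semitic x []       = refl
count-semitic x (R ∷ Rs) = trans (count-++ x (reverse R) (semitic Rs))
  (cong₂ _+_ (count-reverse x R) (count-semitic x Rs))

semitic-prefix-row : ∀ Rs u₁ u₂ → u₁ ++ u₂ ≡ semitic Rs →
  Σ ℕ λ r → ∀ x → countAbove Rs x r ≤ count x u₁ × count x u₁ ≤ countAbove Rs x (suc r)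
semitic-prefix-row []       []  u₂ eq = 0 , λ x → z≤n , z≤n
semitic-prefix-row (R ∷ Rs) u₁ u₂ eq with ++-split u₁ u₂ (reverse R) (semitic Rs) eq
... | inj₁ (m , e₁ , e₂) = 0 , λ x → z≤n ,
      subst (count x u₁ ≤_) (trans (cong (count x) (sym e₁)) (trans (count-reverse x R) (sym (+-identityʳ _))))
        (count-++-≤ˡ x u₁ m)
... | inj₂ (m , e₁ , e₂) with semitic-prefix-row Rs m u₂ (sym e₂)
... | r , h = suc r , λ x →
  let c = trans (cong (count x) e₁) (trans (count-++ x (reverse R) m) (cong (_+ count x m) (count-reverse x R))) in
  subst (_ ≤_) (sym c) (+-monoʳ-≤ (count x R) (proj₁ (h x))) ,
  subst (_≤ _) (sym c) (+-monoʳ-≤ (count x R) (proj₂ (h x)))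

semitic-middle : ∀ Top Y Bot → semitic (Top ++ Y ∷ Bot) ≡ semitic Top ++ reverse Y ++ semitic Bot
semitic-middle Top Y Bot = concatMap-++ reverse Top (Y ∷ Bot)

reverse-around : ∀ (P L R Q : List ℕ) z → P ++ reverse (L ++ z ∷ R) ++ Q ≡ (P ++ reverse R) ++ z ∷ (reverse L ++ Q)
reverse-around P L R Q z = begin
  P ++ reverse (L ++ z ∷ R) ++ Q                  ≡⟨ cong (λ t → P ++ t ++ Q) (reverse-++ L (z ∷ R)) ⟩
  P ++ (reverse (z ∷ R) ++ reverse L) ++ Q        ≡⟨ cong (λ t → P ++ (t ++ reverse L) ++ Q) (unfold-reverse z R) ⟩
  P ++ ((reverse R ++ z ∷ []) ++ reverse L) ++ Q  ≡⟨ cong (P ++_) (++-assoc (reverse R ++ z ∷ []) (reverse L) Q) ⟩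
  P ++ (reverse R ++ z ∷ []) ++ (reverse L ++ Q)  ≡⟨ cong (P ++_) (++-assoc (reverse R) (z ∷ []) _) ⟩
  P ++ reverse R ++ z ∷ (reverse L ++ Q)          ≡⟨ sym (++-assoc P (reverse R) _) ⟩
  (P ++ reverse R) ++ z ∷ (reverse L ++ Q)        ∎
  where open ≡-Reasoning

tableau-from-semitic : ∀ (X Y : Tableau) → map length X ≡ map length Y → semitic X ≡ semitic Y → X ≡ Y
tableau-from-semitic []      []      _ _ = refl
tableau-from-semitic (x ∷ X) (y ∷ Y) l e with ∷-injective l
... | lx , l' with ++-injective-length (reverse x) (reverse y) (semitic X) (semitic Y)
                     (trans (length-reverse x) (trans lx (sym (length-reverse y)))) e
... | e₁ , e₂ = cong₂ _∷_ (reverse-injective e₁) (tableau-from-semitic X Y l' e₂)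

count-suc-singleton : ∀ a → count (suc a) (suc a ∷ []) ≡ 1
count-suc-singleton a = trans (count-singleton (suc a) (suc a)) (occ-self (suc a))

count-pred-singleton : ∀ a → count a (suc a ∷ []) ≡ 0
count-pred-singleton a = trans (count-singleton a (suc a)) (occ-≢ {a} (1+n≢n ∘ sym))

antiDominant-dominant-disjoint : ∀ a p m v → AntiDominantFor a (p ++ m) → DominantFor a (m ++ suc a ∷ v) → ⊥
antiDominant-dominant-disjoint a p m v anti dom = <⇒≱ excess (anti p m refl)
  where
    excess : count (suc a) m < count a m
    excess = subst₂ _≤_
      (trans (count-++ (suc a) m _) (trans (cong (count (suc a) m +_) (count-suc-singleton a)) (+-comm _ 1)))
      (trans (count-++ a m _) (trans (cong (count a m +_) (count-pred-singleton a)) (+-identityʳ _)))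
      (dom (m ++ suc a ∷ []) v (sym (++-assoc m (suc a ∷ []) v)))

raiseWord-unique : ∀ {a w w₁ w₂} → RaiseWord a w w₁ → RaiseWord a w w₂ → w₁ ≡ w₂
raiseWord-unique {a} (u , v , e , anti , dom , e₁) (u' , v' , e' , anti' , dom' , e₂)
  with ++-split u (suc a ∷ v) u' (suc a ∷ v') (trans (sym e) e')
... | inj₁ ([] , p₁ , p₂) rewrite ++-identityʳ u | proj₂ (∷-injective p₂) =
  trans e₁ (sym (trans e₂ (cong (λ t → t ++ a ∷ v') p₁)))
... | inj₂ ([] , p₁ , p₂) rewrite ++-identityʳ u' | proj₂ (∷-injective p₂) =
  trans e₁ (sym (trans e₂ (cong (λ t → t ++ a ∷ v) (sym p₁))))
... | inj₁ (z ∷ m , p₁ , p₂) with ∷-injective p₂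
...   | refl , p₃ = ⊥-elim (antiDominant-dominant-disjoint a (u ++ suc a ∷ []) m v'
          (subst (AntiDominantFor a) (trans p₁ (sym (++-assoc u (suc a ∷ []) m))) anti') (subst (DominantFor a) p₃ dom))
raiseWord-unique {a} (u , v , e , anti , dom , e₁) (u' , v' , e' , anti' , dom' , e₂)
  | inj₂ (z ∷ m , p₁ , p₂) with ∷-injective p₂
...   | refl , p₃ = ⊥-elim (antiDominant-dominant-disjoint a (u' ++ suc a ∷ []) m v
          (subst (AntiDominantFor a) (trans p₁ (sym (++-assoc u' (suc a ∷ []) m))) anti) (subst (DominantFor a) p₃ dom'))

raiseTab-unique : ∀ {a Ts T₁ T₂} → RaiseTab a Ts T₁ → RaiseTab a Ts T₂ → T₁ ≡ T₂
raiseTab-unique {T₁ = T₁} {T₂} (l₁ , r₁) (l₂ , r₂) = tableau-from-semitic T₁ T₂ (trans (sym l₁) l₂) (raiseWord-unique r₁ r₂)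

chain-≤ : ∀ {i l Ts U} → Chain i l Ts U → i ≤ l
chain-≤ done       = ≤-refl
chain-≤ (step _ c) = ≤-trans (n≤1+n _) (chain-≤ c)

chain-trivial : ∀ {a i Ts Ti} → Chain a i Ts Ti → i ≤ a → Ti ≡ Ts
chain-trivial done        _   = refl
chain-trivial (step _ ch) i≤a = ⊥-elim (<⇒≱ (chain-≤ ch) i≤a)

chain-after-step : ∀ (P : Tableau → Set) (_◁_ : ℕ → ℕ → Set) {a l Ts T'} → RaiseTab a Ts T' → (a ◁ l → P Ts) →
                   (∀ i Ti → i ◁ l → Chain (suc a) i T' Ti → P Ti) → ∀ i Ti → i ◁ l → Chain a i Ts Ti → P Ti
chain-after-step P _◁_ r here later i Ti i◁l done         = here i◁l
chain-after-step P _◁_ r here later i Ti i◁l (step r' ch) = later i Ti i◁l (subst (λ t → Chain _ i t Ti) (raiseTab-unique r' r) ch)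

WeaklyIncreasing : List ℕ → Set
WeaklyIncreasing xs = ∀ p x x' → nth xs p ≡ just x → nth xs (suc p) ≡ just x' → x ≤ x'

module TableauRows (outer inner : List ℕ) (Ts : Tableau) (shape : SkewShape outer inner) (tab : Tab outer inner Ts) where

  row-end : ∀ s → part inner s + length (row Ts s) ≡ part outer s
  row-end s = trans (cong (part inner s +_) (proj₁ tab s)) (m+[n∸m]≡n (proj₂ (proj₂ shape) s))

  Σ<-occ-grid : ∀ c s H → part outer s ≤ H → Σ< (λ j → occ c (grid inner Ts s j)) H ≡ count c (row Ts s)
  Σ<-occ-grid c s H p = Σ<-occ-rowGrid c (part inner s) (row Ts s) H (subst (_≤ H) (sym (row-end s)) p)

  grid-sorted : ∀ i j j' x x' → j ≤ j' → grid inner Ts i j ≡ just x → grid inner Ts i j' ≡ just x' → x ≤ x'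
  grid-sorted i = rowGrid-sorted (part inner i) (row Ts i) (proj₁ (proj₂ tab) i)

  row-weaklyIncreasing : ∀ s → WeaklyIncreasing (row Ts s)
  row-weaklyIncreasing s p x x' e e' = proj₁ (proj₂ tab) s (part inner s + p) x x'
    (trans (rowGrid-offset (part inner s) (row Ts s) p) e)
    (trans (cong (rowGrid (part inner s) (row Ts s)) (sym (+-suc (part inner s) p)))
           (trans (rowGrid-offset (part inner s) (row Ts s) (suc p)) e'))

  -- each a + 1 of row i + 1 lies below an entry that is ≥ a by the row order and < a + 1 by the column order
  count-suc-below-≤ : ∀ i t a → grid inner Ts i t ≡ just a → (∀ j → grid inner Ts (suc i) j ≡ just (suc a) → t ≤ j) →
                      count (suc a) (row Ts (suc i)) ≤ count a (row Ts i)
  count-suc-below-≤ i t a at-t right-of-t = begin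
    count (suc a) (row Ts (suc i))                        ≡⟨ sym (Σ<-occ-grid (suc a) (suc i) H (proj₁ shape i)) ⟩
    Σ< (λ j → occ (suc a) (grid inner Ts (suc i) j)) H    ≤⟨ Σ<-mono-≤ H termwise ⟩
    Σ< (λ j → occ a (grid inner Ts i j)) H                ≡⟨ Σ<-occ-grid a i H ≤-refl ⟩
    count a (row Ts i)                                    ∎
    where
      open ≤-Reasoning
      H = part outer i
      termwise : ∀ j → j < H → occ (suc a) (grid inner Ts (suc i) j) ≤ occ a (grid inner Ts i j)
      termwise j _ with grid inner Ts (suc i) j in e
      ... | nothing = z≤n
      ... | just z with z ≟ suc a
      ...   | no z≢ rewrite occ-≢ {suc a} (z≢ ∘ sym) = z≤n
      ...   | yes refl with rowGrid-filled (part inner i) (row Ts i) j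
                             (≤-trans (proj₁ (rowGrid-bounds (part inner i) (row Ts i) t at-t)) (right-of-t j e))
                             (subst (j <_) (sym (row-end i))
                               (<-≤-trans (subst (j <_) (row-end (suc i)) (proj₂ (rowGrid-bounds (part inner (suc i)) (row Ts (suc i)) j e))) (proj₁ shape i)))
      ...     | w , ew rewrite ew
                     | ≤-antisym (≤-pred (proj₂ (proj₂ tab) i j w (suc a) ew e)) (grid-sorted i t j a w (right-of-t j e) at-t ew)
                     | occ-self a = ≤-refl

m+n≤m⇒n≡0 : ∀ m n → m + n ≤ m → n ≡ 0
m+n≤m⇒n≡0 m n h = n≤0⇒n≡0 (+-cancelˡ-≤ m n 0 (subst (m + n ≤_) (sym (+-identityʳ m)) h))

difference-bound : ∀ {X M X' M' A B s₀ s₁ ρ} → X + M ≡ A → X' + M' ≡ B → s₀ ≤ X → X' ≤ s₁ →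
                   A + s₁ + 1 ≤ B + suc ρ + s₀ → M ≤ M' + ρ
difference-bound {X} {M} {X'} {M'} {A} {B} {s₀} {s₁} {ρ} eA eB s₀≤X X'≤s₁ h =
  +-cancelʳ-≤ (s₀ + s₁ + 1) M (M' + ρ) (begin
    M + (s₀ + s₁ + 1)     ≤⟨ +-monoʳ-≤ M (+-monoˡ-≤ 1 (+-monoˡ-≤ s₁ s₀≤X)) ⟩
    M + (X + s₁ + 1)      ≡⟨ shuffle₁ M X s₁ ⟩
    X + M + s₁ + 1        ≡⟨ cong (λ t → t + s₁ + 1) eA ⟩
    A + s₁ + 1            ≤⟨ h ⟩
    B + suc ρ + s₀        ≡⟨ cong (λ t → t + suc ρ + s₀) (sym eB) ⟩
    X' + M' + suc ρ + s₀  ≤⟨ +-monoˡ-≤ s₀ (+-monoˡ-≤ (suc ρ) (+-monoˡ-≤ M' X'≤s₁)) ⟩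
    s₁ + M' + suc ρ + s₀  ≡⟨ shuffle₂ s₁ M' ρ s₀ ⟩
    M' + ρ + (s₀ + s₁ + 1) ∎)
  where
    open ≤-Reasoning
    shuffle₁ : ∀ M X s₁ → M + (X + s₁ + 1) ≡ X + M + s₁ + 1
    shuffle₁ = solve-∀
    shuffle₂ : ∀ s₁ M' ρ s₀ → s₁ + M' + suc ρ + s₀ ≡ M' + ρ + (s₀ + s₁ + 1)
    shuffle₂ = solve-∀

weaklyIncreasing-head : ∀ {z} zs → WeaklyIncreasing (z ∷ zs) → All (z ≤_) zs
weaklyIncreasing-head         []       h = []
weaklyIncreasing-head {z} (w ∷ ws) h = z≤w ∷ All.map (≤-trans z≤w) (weaklyIncreasing-head ws (h ∘ suc))
  where z≤w = h 0 z w refl refl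

first-occurrence : ∀ x xs → WeaklyIncreasing xs → 0 < count x xs →
  Σ (List ℕ) λ L → Σ (List ℕ) λ R → xs ≡ L ++ x ∷ R × All (_< x) L × All (x ≤_) R
first-occurrence x []       h ()
first-occurrence x (z ∷ zs) h c with x ≟ z
... | yes refl = [] , zs , refl , [] , weaklyIncreasing-head zs h
... | no x≢z with first-occurrence x zs (h ∘ suc) (subst (0 <_) (trans (count-cons x z zs) (cong (_+ count x zs) (occ-≢ x≢z))) c)
... | L , R , e , L<x , x≤R = z ∷ L , R , cong (z ∷_) e , z<x ∷ L<x , x≤R
  where z<x = ≤∧≢⇒< (All.head (++⁻ʳ L (subst (All (z ≤_)) e (weaklyIncreasing-head zs h)))) (x≢z ∘ sym)

module RaiseFirst (Top Bot : Tableau) (L R : List ℕ) (a : ℕ) (L<a+1 : All (_< suc a) L) (a+1≤R : All (suc a ≤_) R) where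

  Y = L ++ suc a ∷ R
  T₀ = Top ++ Y ∷ Bot
  T₁ = Top ++ (L ++ a ∷ R) ∷ Bot
  y = length Top

  count-a+1-L : count (suc a) L ≡ 0
  count-a+1-L = count-All-≢ L L<a+1 (λ z z<a+1 e → <-irrefl (sym e) z<a+1)

  count-a-R : count a R ≡ 0
  count-a-R = count-All-≢ R a+1≤R (λ z a+1≤z e → <-irrefl e a+1≤z)

  count-a-Y : count a Y ≡ count a L
  count-a-Y = begin
    count a Y                                 ≡⟨ count-++ a L (suc a ∷ R) ⟩
    count a L + count a (suc a ∷ R)           ≡⟨ cong (count a L +_) (count-cons a (suc a) R) ⟩
    count a L + (occ a (just (suc a)) + count a R) ≡⟨ cong₂ (λ p q → count a L + (p + q)) (occ-≢ {a} (1+n≢n ∘ sym)) count-a-R ⟩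
    count a L + 0                             ≡⟨ +-identityʳ _ ⟩
    count a L                                 ∎
    where open ≡-Reasoning

  count-a+1-Y : count (suc a) Y ≡ suc (count (suc a) R)
  count-a+1-Y = begin
    count (suc a) Y                                  ≡⟨ count-++ (suc a) L (suc a ∷ R) ⟩
    count (suc a) L + count (suc a) (suc a ∷ R)      ≡⟨ cong₂ _+_ count-a+1-L (count-cons (suc a) (suc a) R) ⟩
    occ (suc a) (just (suc a)) + count (suc a) R     ≡⟨ cong (_+ count (suc a) R) (occ-self (suc a)) ⟩
    suc (count (suc a) R)                            ∎
    where open ≡-Reasoning

  countAbove-upper : ∀ x r → r ≤ y → countAbove T₀ x r ≡ countAbove Top x r
  countAbove-upper x r r≤y = countAbove-++ˡ Top (Y ∷ Bot) x r r≤y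

  countAbove-lower : ∀ x n → countAbove T₀ x (y + n) ≡ countAbove Top x y + countAbove (Y ∷ Bot) x n
  countAbove-lower x n = countAbove-++ʳ Top (Y ∷ Bot) x n

  countAbove-through : ∀ x → countAbove T₀ x (suc y) ≡ countAbove Top x y + count x Y
  countAbove-through x = begin
    countAbove T₀ x (suc y)                        ≡⟨ cong (countAbove T₀ x) (+-comm 1 y) ⟩
    countAbove T₀ x (y + 1)                        ≡⟨ countAbove-lower x 1 ⟩
    countAbove Top x y + (count x Y + 0)           ≡⟨ cong (countAbove Top x y +_) (+-identityʳ _) ⟩
    countAbove Top x y + count x Y                 ∎
    where open ≡-Reasoning

  count-semitic-split : ∀ x u₁ m → semitic Top ≡ u₁ ++ m → count x u₁ + count x m ≡ countAbove Top x y
  count-semitic-split x u₁ m e = trans (sym (count-++ x u₁ m)) (trans (cong (count x) (sym e)) (count-semitic x Top))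

  -- the counting conditions, on the rows above and below row y, under which e_a changes this entry
  AboveCondition BelowCondition : Set
  AboveCondition = ∀ r → r < y →
    countAbove T₀ a y + countAbove T₀ (suc a) (suc r) + 1 ≤ countAbove T₀ (suc a) (suc y) + countAbove T₀ a r
  BelowCondition = ∀ n →
    countAbove T₀ (suc a) (y + suc (suc n)) + countAbove T₀ a y ≤ countAbove T₀ a (y + suc n) + countAbove T₀ (suc a) (suc y)

  antiDominant : AboveCondition → AntiDominantFor a (semitic Top ++ reverse R)
  antiDominant above u₁ u₂ eq with ++-split u₁ u₂ (semitic Top) (reverse R) (sym eq)
  ... | inj₂ (m , _ , e₂) = subst (_≤ count (suc a) u₂) (sym no-a) z≤n
    where no-a : count a u₂ ≡ 0
          no-a = n≤0⇒n≡0 (≤-trans (count-++-≤ʳ a m u₂)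
                   (≤-reflexive (trans (cong (count a) (sym e₂)) (trans (count-reverse a R) count-a-R))))
  ... | inj₁ (m , e₁ , refl) with semitic-prefix-row Top u₁ m (sym e₁)
  ... | r , bounds
    rewrite count-++ a m (reverse R) | count-++ (suc a) m (reverse R)
          | count-reverse a R | count-reverse (suc a) R | count-a-R | +-identityʳ (count a m)
    with y ≤? r
  ...   | yes y≤r = subst (_≤ count (suc a) m + count (suc a) R) (sym no-a) z≤n
    where no-a : count a m ≡ 0
          no-a = m+n≤m⇒n≡0 (count a u₁) (count a m) (begin
            count a u₁ + count a m       ≡⟨ count-semitic-split a u₁ m e₁ ⟩
            countAbove Top a y           ≡⟨ sym (countAbove-saturated Top a r y≤r) ⟩
            countAbove Top a r           ≤⟨ proj₁ (bounds a) ⟩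
            count a u₁                   ∎)
            where open ≤-Reasoning
  ...   | no y≰r = difference-bound (count-semitic-split a u₁ m e₁) (count-semitic-split (suc a) u₁ m e₁)
                     (proj₁ (bounds a)) (proj₂ (bounds (suc a))) (subst₂ _≤_
                       (cong₂ (λ p q → p + q + 1) (countAbove-upper a y ≤-refl) (countAbove-upper (suc a) (suc r) r<y))
                       (cong₂ _+_ (trans (countAbove-through (suc a)) (cong (countAbove Top (suc a) y +_) count-a+1-Y))
                                  (countAbove-upper a r (<⇒≤ r<y)))
                       (above r r<y))
    where r<y = ≰⇒> y≰r

  dominant-below : BelowCondition → ∀ r → countAbove Bot (suc a) (suc r) ≤ count a L + countAbove Bot a r
  dominant-below below r = +-cancelʳ-≤ (B + c + A) _ _ (subst₂ _≤_ lhs rhs (below r))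
    where
      A = countAbove Top a y
      B = countAbove Top (suc a) y
      c = count (suc a) Y
      lhs : countAbove T₀ (suc a) (y + suc (suc r)) + countAbove T₀ a y ≡ countAbove Bot (suc a) (suc r) + (B + c + A)
      lhs = trans (cong₂ _+_ (countAbove-lower (suc a) (suc (suc r))) (countAbove-upper a y ≤-refl))
                  (shuffle B c (countAbove Bot (suc a) (suc r)) A)
        where shuffle : ∀ B c X A → B + (c + X) + A ≡ X + (B + c + A)
              shuffle = solve-∀
      rhs : countAbove T₀ a (y + suc r) + countAbove T₀ (suc a) (suc y) ≡ count a L + countAbove Bot a r + (B + c + A)
      rhs = trans (cong₂ _+_ (trans (countAbove-lower a (suc r)) (cong (λ t → A + (t + countAbove Bot a r)) count-a-Y))
                             (countAbove-through (suc a)))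
                  (shuffle A (count a L) (countAbove Bot a r) B c)
        where shuffle : ∀ A l Z B c → A + (l + Z) + (B + c) ≡ l + Z + (B + c + A)
              shuffle = solve-∀

  dominant : BelowCondition → DominantFor a (reverse L ++ semitic Bot)
  dominant below v₁ v₂ eq with ++-split v₁ v₂ (reverse L) (semitic Bot) (sym eq)
  ... | inj₁ (m , e₁ , _) = subst (_≤ count a v₁) (sym no-a+1) z≤n
    where no-a+1 : count (suc a) v₁ ≡ 0
          no-a+1 = n≤0⇒n≡0 (≤-trans (count-++-≤ˡ (suc a) v₁ m)
                     (≤-reflexive (trans (cong (count (suc a)) (sym e₁)) (trans (count-reverse (suc a) L) count-a+1-L))))
  ... | inj₂ (m , refl , e₂) with semitic-prefix-row Bot m v₂ (sym e₂)
  ... | r , bounds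
    rewrite count-++ a (reverse L) m | count-++ (suc a) (reverse L) m
          | count-reverse a L | count-reverse (suc a) L | count-a+1-L = begin
      count (suc a) m                 ≤⟨ proj₂ (bounds (suc a)) ⟩
      countAbove Bot (suc a) (suc r)  ≤⟨ dominant-below below r ⟩
      count a L + countAbove Bot a r  ≤⟨ +-monoʳ-≤ (count a L) (proj₁ (bounds a)) ⟩
      count a L + count a m           ∎
    where open ≤-Reasoning

  length-lowered : length (L ++ a ∷ R) ≡ length Y
  length-lowered = trans (length-++ L) (sym (length-++ L))

  row-lengths : map length T₀ ≡ map length T₁
  row-lengths = begin
    map length T₀                                           ≡⟨ map-++ length Top (Y ∷ Bot) ⟩
    map length Top ++ length Y ∷ map length Bot             ≡⟨ cong (λ t → map length Top ++ t ∷ map length Bot) (sym length-lowered) ⟩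
    map length Top ++ length (L ++ a ∷ R) ∷ map length Bot  ≡⟨ sym (map-++ length Top _) ⟩
    map length T₁                                           ∎
    where open ≡-Reasoning

  raise : AboveCondition → BelowCondition → RaiseTab a T₀ T₁
  raise above below = row-lengths , semitic Top ++ reverse R , reverse L ++ semitic Bot ,
    trans (semitic-middle Top Y Bot) (reverse-around (semitic Top) L R (semitic Bot) (suc a)) ,
    antiDominant above , dominant below ,
    trans (semitic-middle Top (L ++ a ∷ R) Bot) (reverse-around (semitic Top) L R (semitic Bot) a)

  -- the prefix of the reading word ending with the raised letter violates κ-dominance
  not-dominant : ∀ κ → part κ a + countAbove T₀ a y < part κ (suc a) + countAbove T₀ (suc a) (suc y) →
                 ¬ KappaDominant κ T₀
  not-dominant κ excess dom = <⇒≱ excess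
    (subst₂ _≤_ (cong (part κ (suc a) +_) count-a+1-u) (cong (part κ a +_) count-a-u) (dom u w split a))
    where
      u = (semitic Top ++ reverse R) ++ suc a ∷ []
      w = reverse L ++ semitic Bot
      split : semitic T₀ ≡ u ++ w
      split = trans (semitic-middle Top Y Bot) (trans (reverse-around (semitic Top) L R (semitic Bot) (suc a))
                (sym (++-assoc (semitic Top ++ reverse R) (suc a ∷ []) w)))
      count-u : ∀ x → count x u ≡ countAbove Top x y + count x R + count x (suc a ∷ [])
      count-u x = trans (count-++ x (semitic Top ++ reverse R) (suc a ∷ []))
                   (cong (_+ count x (suc a ∷ [])) (trans (count-++ x (semitic Top) (reverse R))
                     (cong₂ _+_ (count-semitic x Top) (count-reverse x R))))
      count-a-u : count a u ≡ countAbove T₀ a y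
      count-a-u = begin
        count a u                                              ≡⟨ count-u a ⟩
        countAbove Top a y + count a R + count a (suc a ∷ [])  ≡⟨ cong₂ (λ p q → countAbove Top a y + p + q) count-a-R (count-pred-singleton a) ⟩
        countAbove Top a y + 0 + 0                             ≡⟨ trans (+-identityʳ _) (+-identityʳ _) ⟩
        countAbove Top a y                                     ≡⟨ sym (countAbove-upper a y ≤-refl) ⟩
        countAbove T₀ a y                                      ∎
        where open ≡-Reasoning
      count-a+1-u : count (suc a) u ≡ countAbove T₀ (suc a) (suc y)
      count-a+1-u = begin
        count (suc a) u                                        ≡⟨ count-u (suc a) ⟩
        countAbove Top (suc a) y + count (suc a) R + count (suc a) (suc a ∷ [])
                                                               ≡⟨ cong (countAbove Top (suc a) y + count (suc a) R +_) (count-suc-singleton a) ⟩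
        countAbove Top (suc a) y + count (suc a) R + 1         ≡⟨ shuffle (countAbove Top (suc a) y) (count (suc a) R) ⟩
        countAbove Top (suc a) y + suc (count (suc a) R)       ≡⟨ cong (countAbove Top (suc a) y +_) (sym count-a+1-Y) ⟩
        countAbove Top (suc a) y + count (suc a) Y             ≡⟨ sym (countAbove-through (suc a)) ⟩
        countAbove T₀ (suc a) (suc y)                          ∎
        where
          open ≡-Reasoning
          shuffle : ∀ p q → p + q + 1 ≡ p + suc q
          shuffle = solve-∀

  row-T₀-y : row T₀ y ≡ Y
  row-T₀-y = row-middle Top Bot Y

  row-T₁-y : row T₁ y ≡ L ++ a ∷ R
  row-T₁-y = row-middle Top Bot (L ++ a ∷ R)

  row-T₁-≢ : ∀ s → ¬ s ≡ y → row T₁ s ≡ row T₀ s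
  row-T₁-≢ s s≢y = row-middle-≢ Top Bot (L ++ a ∷ R) Y s s≢y

  count-lowered : ∀ i → count i (L ++ a ∷ R) + occ i (just (suc a)) ≡ count i Y + occ i (just a)
  count-lowered i = begin
    count i (L ++ a ∷ R) + occ i (just (suc a))                 ≡⟨ cong (_+ occ i (just (suc a))) (expand a) ⟩
    count i L + (occ i (just a) + count i R) + occ i (just (suc a)) ≡⟨ shuffle (count i L) (occ i (just a)) (count i R) (occ i (just (suc a))) ⟩
    count i L + (occ i (just (suc a)) + count i R) + occ i (just a) ≡⟨ cong (_+ occ i (just a)) (sym (expand (suc a))) ⟩
    count i Y + occ i (just a)                                   ∎
    where
      open ≡-Reasoning
      expand : ∀ z → count i (L ++ z ∷ R) ≡ count i L + (occ i (just z) + count i R)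
      expand z = trans (count-++ i L (z ∷ R)) (cong (count i L +_) (count-cons i z R))
      shuffle : ∀ p q r s → p + (q + r) + s ≡ p + (s + r) + q
      shuffle = solve-∀

  module Semistandard (χλ χμ : List ℕ) (χ : SkewShape χλ χμ) (tab₀ : Tab χλ χμ T₀) where
    open TableauRows χλ χμ T₀ χ tab₀

    o = part χμ y
    t = o + length L
    column₀ = proj₂ (proj₂ tab₀)

    grid-T₀-y : ∀ j → grid χμ T₀ y j ≡ rowGrid o Y j
    grid-T₀-y j = cong (λ r → rowGrid o r j) row-T₀-y

    grid-T₁-y : ∀ j → grid χμ T₁ y j ≡ rowGrid o (L ++ a ∷ R) j
    grid-T₁-y j = cong (λ r → rowGrid o r j) row-T₁-y

    grid-T₀-t : grid χμ T₀ y t ≡ just (suc a)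
    grid-T₀-t = trans (grid-T₀-y t) (trans (rowGrid-offset o Y (length L)) (nth-middle L R (suc a)))

    grid-T₁-t : grid χμ T₁ y t ≡ just a
    grid-T₁-t = trans (grid-T₁-y t) (trans (rowGrid-offset o (L ++ a ∷ R) (length L)) (nth-middle L R a))

    grid-T₁-≢ : ∀ i j → ¬ (i ≡ y × j ≡ t) → grid χμ T₁ i j ≡ grid χμ T₀ i j
    grid-T₁-≢ i j ne with i ≟ y
    ... | no i≢y = cong (λ r → rowGrid (part χμ i) r j) (row-T₁-≢ i i≢y)
    ... | yes refl with j <? o
    ...   | yes j<o = trans (grid-T₁-y j) (trans (rowGrid-below o (L ++ a ∷ R) j j<o) (sym (trans (grid-T₀-y j) (rowGrid-below o Y j j<o))))
    ...   | no j≮o = begin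
      grid χμ T₁ y j                 ≡⟨ grid-T₁-y j ⟩
      rowGrid o (L ++ a ∷ R) j       ≡⟨ rowGrid-above o (L ++ a ∷ R) j o≤j ⟩
      nth (L ++ a ∷ R) (j ∸ o)       ≡⟨ nth-middle-≢ L R a (suc a) (j ∸ o) (λ e → ne (refl , trans (sym (m+[n∸m]≡n o≤j)) (cong (o +_) e))) ⟩
      nth Y (j ∸ o)                  ≡⟨ sym (rowGrid-above o Y j o≤j) ⟩
      rowGrid o Y j                  ≡⟨ sym (grid-T₀-y j) ⟩
      grid χμ T₀ y j                 ∎
      where open ≡-Reasoning
            o≤j = ≮⇒≥ j≮o

    left-of-t : ∀ j x → j < t → grid χμ T₀ y j ≡ just x → x < suc a
    left-of-t j x j<t e = nth-All L (j ∸ o) L<a+1 (begin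
      nth L (j ∸ o)                  ≡⟨ sym (nth-++ˡ L (suc a ∷ R) (j ∸ o) j∸o<) ⟩
      nth Y (j ∸ o)                  ≡⟨ sym (rowGrid-above o Y j o≤j) ⟩
      rowGrid o Y j                  ≡⟨ sym (grid-T₀-y j) ⟩
      grid χμ T₀ y j                 ≡⟨ e ⟩
      just x                         ∎)
      where
        open ≡-Reasoning
        o≤j = proj₁ (rowGrid-bounds o Y j (trans (sym (grid-T₀-y j)) e))
        j∸o< : j ∸ o < length L
        j∸o< = +-cancelˡ-< o _ _ (subst (_< t) (sym (m+[n∸m]≡n o≤j)) j<t)

    right-of-t : ∀ j x → t < j → grid χμ T₀ y j ≡ just x → suc a ≤ x
    right-of-t j x t<j e = nth-All R d a+1≤R (begin
      nth R d                               ≡⟨ sym (nth-++ʳ L (suc a ∷ R) (suc d)) ⟩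
      nth Y (length L + suc d)              ≡⟨ sym (rowGrid-offset o Y (length L + suc d)) ⟩
      rowGrid o Y (o + (length L + suc d))  ≡⟨ cong (rowGrid o Y) j≡ ⟩
      rowGrid o Y j                         ≡⟨ sym (grid-T₀-y j) ⟩
      grid χμ T₀ y j                        ≡⟨ e ⟩
      just x                                ∎)
      where
        open ≡-Reasoning
        d = j ∸ suc t
        j≡ : o + (length L + suc d) ≡ j
        j≡ = trans (sym (+-assoc o (length L) (suc d))) (trans (+-suc t d) (m+[n∸m]≡n t<j))

    lengths₁ : ∀ i → length (row T₁ i) ≡ part χλ i ∸ part χμ i
    lengths₁ i with i ≟ y
    ... | no i≢y = trans (cong length (row-T₁-≢ i i≢y)) (proj₁ tab₀ i)
    ... | yes refl = trans (cong length row-T₁-y) (trans length-lowered (trans (cong length (sym row-T₀-y)) (proj₁ tab₀ y)))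

    rows₁ : ∀ i j x x' → grid χμ T₁ i j ≡ just x → grid χμ T₁ i (suc j) ≡ just x' → x ≤ x'
    rows₁ i j x x' e e' with i ≟ y
    ... | no i≢y = proj₁ (proj₂ tab₀) i j x x' (trans (sym (grid-T₁-≢ i j (i≢y ∘ proj₁))) e)
                                               (trans (sym (grid-T₁-≢ i (suc j) (i≢y ∘ proj₁))) e')
    ... | yes refl with j ≟ t | suc j ≟ t
    ...   | yes refl | _ = subst (_≤ x') (just-injective (trans (sym grid-T₁-t) e))
              (≤-trans (n≤1+n a) (right-of-t (suc t) x' ≤-refl (trans (sym (grid-T₁-≢ y (suc t) (1+n≢n ∘ proj₂))) e')))
    ...   | no j≢t | yes j+1≡t = subst (x ≤_) (just-injective (trans (sym (trans (cong (grid χμ T₁ y) j+1≡t) grid-T₁-t)) e'))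
              (≤-pred (left-of-t j x (≤-reflexive j+1≡t) (trans (sym (grid-T₁-≢ y j (j≢t ∘ proj₂))) e)))
    ...   | no j≢t | no j+1≢t = proj₁ (proj₂ tab₀) y j x x' (trans (sym (grid-T₁-≢ y j (j≢t ∘ proj₂))) e)
                                                           (trans (sym (grid-T₁-≢ y (suc j) (j+1≢t ∘ proj₂))) e')

    -- every a + 1 of row y would lie below an a, against the condition at r = i
    not-a-above : AboveCondition → ∀ i → suc i ≡ y → ¬ grid χμ T₀ i t ≡ just a
    not-a-above above i i+1≡y a-above =
      <⇒≱ (more-a+1 (subst₂ _≤_ lhs rhs (above i (≤-reflexive i+1≡y)))) (count-suc-below-≤ i t a a-above right-of-a)
      where
        Aa = countAbove T₀ a i
        Ab = countAbove T₀ (suc a) (suc i)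
        ca = count a (row T₀ i)
        cb = count (suc a) (row T₀ (suc i))
        right-of-a : ∀ j → grid χμ T₀ (suc i) j ≡ just (suc a) → t ≤ j
        right-of-a j e = ≮⇒≥ (λ j<t → <-irrefl refl (left-of-t j (suc a) j<t (trans (cong (λ r → grid χμ T₀ r j) (sym i+1≡y)) e)))
        lhs : countAbove T₀ a y + Ab + 1 ≡ Aa + ca + Ab + 1
        lhs = cong (λ z → z + Ab + 1) (trans (cong (countAbove T₀ a) (sym i+1≡y)) (Σ<-last (λ s → count a (row T₀ s)) i))
        rhs : countAbove T₀ (suc a) (suc y) + Aa ≡ Ab + cb + Aa
        rhs = cong (_+ Aa) (trans (cong (λ z → countAbove T₀ (suc a) (suc z)) (sym i+1≡y))
                                  (Σ<-last (λ s → count (suc a) (row T₀ s)) (suc i)))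
        more-a+1 : Aa + ca + Ab + 1 ≤ Ab + cb + Aa → suc ca ≤ cb
        more-a+1 h = +-cancelʳ-≤ (Aa + Ab) (suc ca) cb (subst₂ _≤_ (shuffle₁ Aa ca Ab) (shuffle₂ Aa Ab cb) h)
          where shuffle₁ : ∀ Aa ca Ab → Aa + ca + Ab + 1 ≡ suc ca + (Aa + Ab)
                shuffle₁ = solve-∀
                shuffle₂ : ∀ Aa Ab cb → Ab + cb + Aa ≡ cb + (Aa + Ab)
                shuffle₂ = solve-∀

    columns₁ : AboveCondition → ∀ i j x x' → grid χμ T₁ i j ≡ just x → grid χμ T₁ (suc i) j ≡ just x' → x < x'
    columns₁ above i j x x' e e' with i ≟ y | suc i ≟ y | j ≟ t
    ... | yes refl | _ | yes refl = subst (_< x') (just-injective (trans (sym grid-T₁-t) e))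
            (<-trans (n<1+n a) (column₀ y t (suc a) x' grid-T₀-t (trans (sym (grid-T₁-≢ (suc y) t (1+n≢n ∘ proj₁))) e')))
    ... | yes refl | _ | no j≢t = column₀ y j x x' (trans (sym (grid-T₁-≢ y j (j≢t ∘ proj₂))) e)
                                                  (trans (sym (grid-T₁-≢ (suc y) j (1+n≢n ∘ proj₁))) e')
    ... | no i≢y | yes i+1≡y | yes refl = subst (x <_) (just-injective (trans (sym (trans (below i+1≡y T₁) grid-T₁-t)) e'))
            (≤∧≢⇒< (≤-pred (column₀ i t x (suc a) x-above (trans (below i+1≡y T₀) grid-T₀-t)))
                   (not-a-above above i i+1≡y ∘ trans x-above ∘ cong just))
      where x-above = trans (sym (grid-T₁-≢ i t (i≢y ∘ proj₁))) e
            below : suc i ≡ y → ∀ U → grid χμ U (suc i) t ≡ grid χμ U y t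
            below i+1≡y U = cong (λ r → grid χμ U r t) i+1≡y
    ... | no i≢y | yes _ | no j≢t = column₀ i j x x' (trans (sym (grid-T₁-≢ i j (i≢y ∘ proj₁))) e)
                                                      (trans (sym (grid-T₁-≢ (suc i) j (j≢t ∘ proj₂))) e')
    ... | no i≢y | no i+1≢y | _ = column₀ i j x x' (trans (sym (grid-T₁-≢ i j (i≢y ∘ proj₁))) e)
                                                 (trans (sym (grid-T₁-≢ (suc i) j (i+1≢y ∘ proj₁))) e')

    tab₁ : AboveCondition → Tab χλ χμ T₁
    tab₁ above = lengths₁ , rows₁ , columns₁ above

-- Grids in the middle of a jeu de taquin slide

upd-same : ∀ G a b m → upd G a b m a b ≡ m
upd-same G a b m rewrite T⇒≡true (≡⇒≡ᵇ a a refl) | T⇒≡true (≡⇒≡ᵇ b b refl) = refl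

upd-other : ∀ G a b m i j → ¬ (i ≡ a × j ≡ b) → upd G a b m i j ≡ G i j
upd-other G a b m i j ne with i ≟ a | j ≟ b
... | yes refl | yes refl = ⊥-elim (ne (refl , refl))
... | yes refl | no j≢b rewrite T⇒≡true (≡⇒≡ᵇ i i refl) | ¬T⇒≡false (j≢b ∘ ≡ᵇ⇒≡ j b) = refl
... | no i≢a   | _        rewrite ¬T⇒≡false (i≢a ∘ ≡ᵇ⇒≡ i a) = refl

move-source : ∀ G a b a' b' x → move G a b a' b' x a' b' ≡ nothing
move-source G a b a' b' x = upd-same (upd G a b (just x)) a' b' nothing

move-target : ∀ G a b a' b' x → ¬ (a ≡ a' × b ≡ b') → move G a b a' b' x a b ≡ just x
move-target G a b a' b' x ne = trans (upd-other (upd G a b (just x)) a' b' nothing a b ne) (upd-same G a b (just x))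

move-other : ∀ G a b a' b' x i j → ¬ (i ≡ a × j ≡ b) → ¬ (i ≡ a' × j ≡ b') → move G a b a' b' x i j ≡ G i j
move-other G a b a' b' x i j ne ne' = trans (upd-other (upd G a b (just x)) a' b' nothing i j ne') (upd-other G a b (just x) i j ne)

empty-or-related : ∀ {R : ℕ → ℕ → Set} {m x} → m ≡ nothing ⊎ Σ ℕ (λ y → m ≡ just y × R x y) → ∀ {x'} → m ≡ just x' → R x x'
empty-or-related (inj₁ none) e = ⊥-elim (nothing≢just (trans (sym none) e))
empty-or-related {R} (inj₂ (y , ey , r)) e = subst (R _) (just-injective (trans (sym ey) e)) r

n≢1+n : ∀ n → ¬ n ≡ suc n
n≢1+n n = 1+n≢n ∘ sym

-- row i of a grid occupies the columns inner i ≤ j < outer i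
module Sliding (inner outer : ℕ → ℕ)
               (inner-antitone : ∀ i → inner (suc i) ≤ inner i) (outer-antitone : ∀ i → outer (suc i) ≤ outer i) where

  rowCount : Grid → ℕ → ℕ → ℕ
  rowCount G i s = Σ< (λ j → occ s (G i j)) (outer i)

  rowCountBelow : Grid → ℕ → ℕ → ℕ
  rowCountBelow G i r = Σ< (λ j → occBelow r (G i j)) (outer i)

  rowCount-update : ∀ G G' i b s → b < outer i → (∀ j → ¬ j ≡ b → G' i j ≡ G i j) →
                    rowCount G' i s + occ s (G i b) ≡ rowCount G i s + occ s (G' i b)
  rowCount-update G G' i b s b< same =
    Σ<-update (λ j → occ s (G i j)) (λ j → occ s (G' i j)) (outer i) b b< (λ j j≢b → cong (occ s) (same j j≢b))

  -- the state of the slide when the empty square is (a, b); Ts is the companion of the current grid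
  record Midslide (G : Grid) (a b : ℕ) (Ts : Tableau) : Set where
    field
      hole          : G a b ≡ nothing
      hole-inner    : inner a ≤ b
      empty-inner   : ∀ i j → a ≤ i → j < inner i → G i j ≡ nothing
      empty-outer   : ∀ i j → a ≤ i → outer i ≤ j → G i j ≡ nothing
      filled        : ∀ i j → a ≤ i → inner i ≤ j → j < outer i → (i ≡ a → ¬ j ≡ b) → Σ ℕ λ x → G i j ≡ just x
      row-sorted    : ∀ i j j' x x' → a ≤ i → j ≤ j' → G i j ≡ just x → G i j' ≡ just x' → x ≤ x'
      column-strict : ∀ i j x x' → a ≤ i → G i j ≡ just x → G (suc i) j ≡ just x' → x < x'
      companion     : ∀ i s → rowCount G i s ≡ count i (row Ts s)

  countAbove≡rowCountBelow : ∀ G Ts → (∀ i s → rowCount G i s ≡ count i (row Ts s)) →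
                             ∀ i r → countAbove Ts i r ≡ rowCountBelow G i r
  countAbove≡rowCountBelow G Ts comp i r = begin
    countAbove Ts i r                                      ≡⟨ Σ<-cong r (λ s _ → sym (comp i s)) ⟩
    Σ< (λ s → rowCount G i s) r                            ≡⟨ Σ<-swap (λ s j → occ s (G i j)) r (outer i) ⟩
    Σ< (λ j → Σ< (λ s → occ s (G i j)) r) (outer i)        ≡⟨ Σ<-cong (outer i) (λ j _ → Σ<-occ (G i j) r) ⟩
    rowCountBelow G i r                                    ∎
    where open ≡-Reasoning

  entry-bounds : ∀ {G a b Ts} → Midslide G a b Ts → ∀ i j x → a ≤ i → G i j ≡ just x → inner i ≤ j × j < outer i
  entry-bounds I i j x a≤i e =
    ≮⇒≥ (λ j< → nothing≢just (trans (sym (Midslide.empty-inner I i j a≤i j<)) e)) ,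
    ≰⇒> (λ ≤j → nothing≢just (trans (sym (Midslide.empty-outer I i j a≤i ≤j)) e))

  module RightMove {G a b Ts x} (I : Midslide G a b Ts) (ex : G a (suc b) ≡ just x)
                   (below : G (suc a) b ≡ nothing ⊎ Σ ℕ (λ y → G (suc a) b ≡ just y × x < y)) where
    open Midslide I
    G₁ = move G a b a (suc b) x

    b+1<outer : suc b < outer a
    b+1<outer = proj₂ (entry-bounds I a (suc b) x ≤-refl ex)

    G₁-b : G₁ a b ≡ just x
    G₁-b = move-target G a b a (suc b) x (n≢1+n b ∘ proj₂)

    G₁-b+1 : G₁ a (suc b) ≡ nothing
    G₁-b+1 = move-source G a b a (suc b) x

    G₁-other-row : ∀ i j → ¬ i ≡ a → G₁ i j ≡ G i j
    G₁-other-row i j i≢a = move-other G a b a (suc b) x i j (i≢a ∘ proj₁) (i≢a ∘ proj₁)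

    G₁-other-column : ∀ j → ¬ j ≡ b → ¬ j ≡ suc b → G₁ a j ≡ G a j
    G₁-other-column j j≢b j≢b+1 = move-other G a b a (suc b) x a j (j≢b ∘ proj₂) (j≢b+1 ∘ proj₂)

    G₁-other : ∀ i j → ¬ (i ≡ a × j ≡ b) → ¬ (i ≡ a × j ≡ suc b) → G₁ i j ≡ G i j
    G₁-other i j = move-other G a b a (suc b) x i j

    rowCount-moved : ∀ s → rowCount G₁ a s ≡ rowCount G a s
    rowCount-moved s = +-cancelʳ-≡ (occ s (just x)) _ _ (begin
      rowCount G₁ a s + occ s (just x)   ≡⟨ cong (λ m → rowCount G₁ a s + occ s m) (sym H-b+1) ⟩
      rowCount G₁ a s + occ s (H a (suc b)) ≡⟨ rowCount-update H G₁ a (suc b) s b+1<outer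
                                                (λ j j≢ → upd-other H a (suc b) nothing a j (j≢ ∘ proj₂)) ⟩
      rowCount H a s + occ s (G₁ a (suc b)) ≡⟨ cong (λ m → rowCount H a s + occ s m) G₁-b+1 ⟩
      rowCount H a s + 0                 ≡⟨ cong (λ m → rowCount H a s + occ s m) (sym hole) ⟩
      rowCount H a s + occ s (G a b)     ≡⟨ rowCount-update G H a b s (<-trans (n<1+n b) b+1<outer)
                                                (λ j j≢ → upd-other G a b (just x) a j (j≢ ∘ proj₂)) ⟩
      rowCount G a s + occ s (H a b)     ≡⟨ cong (λ m → rowCount G a s + occ s m) (upd-same G a b (just x)) ⟩
      rowCount G a s + occ s (just x)    ∎)
      where
        open ≡-Reasoning
        H = upd G a b (just x)
        H-b+1 : H a (suc b) ≡ just x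
        H-b+1 = trans (upd-other G a b (just x) a (suc b) (n≢1+n b ∘ sym ∘ proj₂)) ex

    x<below : ∀ x' → G (suc a) b ≡ just x' → x < x'
    x<below x' = empty-or-related {_<_} below

    row-sorted₁ : ∀ i j j' x₁ x₂ → a ≤ i → j ≤ j' → G₁ i j ≡ just x₁ → G₁ i j' ≡ just x₂ → x₁ ≤ x₂
    row-sorted₁ i j j' x₁ x₂ a≤i j≤j' e e' with i ≟ a
    ... | no i≢a = row-sorted i j j' x₁ x₂ a≤i j≤j' (trans (sym (G₁-other-row i j i≢a)) e) (trans (sym (G₁-other-row i j' i≢a)) e')
    ... | yes refl with j ≟ suc b | j' ≟ suc b
    ...   | yes refl | _ = ⊥-elim (nothing≢just (trans (sym G₁-b+1) e))
    ...   | no _ | yes refl = ⊥-elim (nothing≢just (trans (sym G₁-b+1) e'))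
    ...   | no j≢b+1 | no j'≢b+1 with j ≟ b | j' ≟ b
    ...     | yes refl | yes refl = ≤-reflexive (just-injective (trans (sym e) e'))
    ...     | yes refl | no j'≢b = subst (_≤ x₂) (just-injective (trans (sym G₁-b) e))
              (row-sorted a (suc b) j' x x₂ a≤i (≤∧≢⇒< j≤j' (j'≢b ∘ sym)) ex (trans (sym (G₁-other-column j' j'≢b j'≢b+1)) e'))
    ...     | no j≢b | yes refl = subst (x₁ ≤_) (just-injective (trans (sym G₁-b) e'))
              (row-sorted a j (suc b) x₁ x a≤i (≤-trans j≤j' (n≤1+n b)) (trans (sym (G₁-other-column j j≢b j≢b+1)) e) ex)
    ...     | no j≢b | no j'≢b = row-sorted a j j' x₁ x₂ a≤i j≤j'
              (trans (sym (G₁-other-column j j≢b j≢b+1)) e) (trans (sym (G₁-other-column j' j'≢b j'≢b+1)) e')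

    column-strict₁ : ∀ i j x₁ x₂ → a ≤ i → G₁ i j ≡ just x₁ → G₁ (suc i) j ≡ just x₂ → x₁ < x₂
    column-strict₁ i j x₁ x₂ a≤i e e' with i ≟ a
    ... | no i≢a = column-strict i j x₁ x₂ a≤i (trans (sym (G₁-other-row i j i≢a)) e)
                     (trans (sym (G₁-other-row (suc i) j (<⇒≢ (s≤s a≤i) ∘ sym))) e')
    ... | yes refl with j ≟ b | j ≟ suc b
    ...   | yes refl | _ = subst (_< x₂) (just-injective (trans (sym G₁-b) e)) (x<below x₂ (trans (sym (G₁-other-row (suc a) b (n≢1+n a ∘ sym))) e'))
    ...   | no _ | yes refl = ⊥-elim (nothing≢just (trans (sym G₁-b+1) e))
    ...   | no j≢b | no j≢b+1 = column-strict a j x₁ x₂ a≤i (trans (sym (G₁-other-column j j≢b j≢b+1)) e)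
                                  (trans (sym (G₁-other-row (suc a) j (n≢1+n a ∘ sym))) e')

    filled₁ : ∀ i j → a ≤ i → inner i ≤ j → j < outer i → (i ≡ a → ¬ j ≡ suc b) → Σ ℕ λ v → G₁ i j ≡ just v
    filled₁ i j a≤i inner≤j j<outer not-hole with i ≟ a
    ... | no i≢a = subst (λ m → Σ ℕ λ v → m ≡ just v) (sym (G₁-other-row i j i≢a)) (filled i j a≤i inner≤j j<outer (⊥-elim ∘ i≢a))
    ... | yes refl with j ≟ b
    ...   | yes refl = x , G₁-b
    ...   | no j≢b = subst (λ m → Σ ℕ λ v → m ≡ just v) (sym (G₁-other-column j j≢b (not-hole refl)))
                       (filled a j a≤i inner≤j j<outer (λ _ → j≢b))

    right-step : Midslide G₁ a (suc b) Ts
    right-step = record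
      { hole          = G₁-b+1
      ; hole-inner    = ≤-trans hole-inner (n≤1+n b)
      ; empty-inner   = λ i j a≤i j< → trans (G₁-other i j (λ { (refl , refl) → <⇒≱ j< hole-inner })
                                                        (λ { (refl , refl) → <⇒≱ j< (≤-trans hole-inner (n≤1+n b)) }))
                                              (empty-inner i j a≤i j<)
      ; empty-outer   = λ i j a≤i ≤j → trans (G₁-other i j (λ { (refl , refl) → <⇒≱ (<-trans (n<1+n b) b+1<outer) ≤j })
                                                        (λ { (refl , refl) → <⇒≱ b+1<outer ≤j }))
                                              (empty-outer i j a≤i ≤j)
      ; filled        = filled₁
      ; row-sorted    = row-sorted₁
      ; column-strict = column-strict₁
      ; companion     = companion₁
      }
      where
        companion₁ : ∀ i s → rowCount G₁ i s ≡ count i (row Ts s)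
        companion₁ i s with i ≟ a
        ... | yes refl = trans (rowCount-moved s) (companion a s)
        ... | no i≢a = trans (Σ<-cong (outer i) (λ j _ → cong (occ s) (G₁-other-row i j i≢a))) (companion i s)

  module DownMove {G a b Ts v} (I : Midslide G a b Ts) (ev : G (suc a) b ≡ just v)
                  (beside : G a (suc b) ≡ nothing ⊎ Σ ℕ (λ x → G a (suc b) ≡ just x × v ≤ x)) where
    open Midslide I
    A = G a
    B = G (suc a)
    H = outer a

    b<outer-below : b < outer (suc a)
    b<outer-below = proj₂ (entry-bounds I (suc a) b v (n≤1+n a) ev)

    b<outer : b < H
    b<outer = <-≤-trans b<outer-below (outer-antitone a)

    v≤right-of-hole : ∀ j x → b < j → A j ≡ just x → v ≤ x
    v≤right-of-hole j x b<j e with filled a (suc b) ≤-refl (≤-trans hole-inner (n≤1+n b))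
                                     (≤-<-trans b<j (proj₂ (entry-bounds I a j x ≤-refl e))) (λ _ → n≢1+n b ∘ sym)
    ... | x' , e' = ≤-trans (empty-or-related {_≤_} beside e') (row-sorted a (suc b) j x' x ≤-refl b<j e' e)

    left-of-hole-below : ∀ j z → j ≤ b → B j ≡ just z → z ≤ v
    left-of-hole-below j z j≤b e = row-sorted (suc a) j b z v (n≤1+n a) j≤b e ev

    below-left-of-hole : ∀ j x → j < b → A j ≡ just x → Σ ℕ λ z → B j ≡ just z × x < z
    below-left-of-hole j x j<b e with filled (suc a) j (n≤1+n a) (≤-trans (inner-antitone a) (proj₁ (entry-bounds I a j x ≤-refl e)))
                                            (<-trans j<b b<outer-below) (⊥-elim ∘ n≢1+n a ∘ sym)
    ... | z , ez = z , ez , column-strict a j x z ≤-refl e ez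

    rowCountBelow-lower : ∀ r → rowCountBelow G (suc a) r ≡ Σ< (λ j → occBelow r (B j)) H
    rowCountBelow-lower r = sym (Σ<-tail-zero (λ j → occBelow r (B j)) (outer (suc a)) H (outer-antitone a)
                                  (λ j ≤j _ → cong (occBelow r) (empty-outer (suc a) j (n≤1+n a) ≤j)))

    none-below-right-of-hole : ∀ r j → b < j → r ≤ v → occBelow r (A j) ≡ 0
    none-below-right-of-hole r j b<j r≤v = occBelow-none (A j) (λ x e → ≤-trans r≤v (v≤right-of-hole j x b<j e))

    below-pos-left-of-hole : ∀ j z → j ≤ b → B j ≡ just z → 1 ≤ occBelow (suc v) (just z)
    below-pos-left-of-hole j z j≤b e = occBelow-pos (just z) refl (s≤s (left-of-hole-below j z j≤b e))

    -- via the companion correspondence, the three inequalities below become the two conditions under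
    -- which e_a changes an a + 1 of row v into a, and the failure of κ'-dominance before that change

    above-termwise : ∀ r → r < v → ∀ j → j < H →
                     occBelow v (A j) + occBelow (suc r) (B j) ≤ occBelow (suc v) (B j) + occBelow r (A j)
    above-termwise r r<v j _ with <-cmp j b
    ... | tri> _ _ b<j rewrite none-below-right-of-hole v j b<j ≤-refl | none-below-right-of-hole r j b<j (<⇒≤ r<v) =
      subst (occBelow (suc r) (B j) ≤_) (sym (+-identityʳ _)) (occBelow-monoˡ (B j) (s≤s (<⇒≤ r<v)))
    ... | tri≈ _ refl _ rewrite hole | ev | occBelow-≥ {suc r} {v} r<v | occBelow-< {suc v} {v} ≤-refl = z≤n
    ... | tri< j<b _ _ with A j in eA
    ...   | nothing = subst (occBelow (suc r) (B j) ≤_) (sym (+-identityʳ _)) (occBelow-monoˡ (B j) (s≤s (<⇒≤ r<v)))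
    ...   | just x with below-left-of-hole j x j<b eA
    ...     | z , ez , x<z rewrite ez =
      +-mono-≤ (≤-trans (occBelow-≤1 v (just x)) (below-pos-left-of-hole j z (<⇒≤ j<b) ez))
               (occBelow-transfer (λ z<r+1 → <-≤-trans x<z (≤-pred z<r+1)))

    above-inequality : ∀ r → r < v →
      rowCountBelow G a v + rowCountBelow G (suc a) (suc r) + 1 ≤ rowCountBelow G (suc a) (suc v) + rowCountBelow G a r
    above-inequality r r<v = subst₂ _≤_
      (trans (+-comm 1 _) (cong (_+ 1) (trans (Σ<-+ (λ j → occBelow v (A j)) (λ j → occBelow (suc r) (B j)) H)
                                             (cong (rowCountBelow G a v +_) (sym (rowCountBelow-lower (suc r)))))))
      (trans (Σ<-+ (λ j → occBelow (suc v) (B j)) (λ j → occBelow r (A j)) H) (cong (_+ rowCountBelow G a r) (sym (rowCountBelow-lower (suc v)))))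
      (Σ<-mono-< H b (above-termwise r r<v) b<outer at-hole)
      where at-hole : occBelow v (A b) + occBelow (suc r) (B b) < occBelow (suc v) (B b) + occBelow r (A b)
            at-hole rewrite hole | ev | occBelow-≥ {suc r} {v} r<v | occBelow-< {suc v} {v} ≤-refl = ≤-refl

    below-termwise : ∀ r → v < r → ∀ j → j < H →
                     occBelow (suc r) (B j) + occBelow v (A j) ≤ occBelow r (A j) + occBelow (suc v) (B j)
    below-termwise r v<r j _ with <-cmp j b
    ... | tri> _ _ b<j rewrite none-below-right-of-hole v j b<j ≤-refl with B j in eB
    ...   | nothing = z≤n
    ...   | just z with z <? suc r
    ...     | no z≮r+1 rewrite occBelow-≥ {suc r} {z} (≮⇒≥ z≮r+1) = z≤n
    ...     | yes z<r+1 with filled a j ≤-refl (≤-trans hole-inner (<⇒≤ b<j))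
                              (<-≤-trans (proj₂ (entry-bounds I (suc a) j z (n≤1+n a) eB)) (outer-antitone a)) (λ _ j≡b → <-irrefl (sym j≡b) b<j)
    ...       | x , ex = begin
      occBelow (suc r) (just z) + 0      ≡⟨ +-identityʳ _ ⟩
      occBelow (suc r) (just z)          ≤⟨ occBelow-≤1 (suc r) (just z) ⟩
      1                                  ≤⟨ occBelow-pos (A j) ex (<-≤-trans (column-strict a j x z ≤-refl ex eB) (≤-pred z<r+1)) ⟩
      occBelow r (A j)                   ≤⟨ m≤m+n _ _ ⟩
      occBelow r (A j) + occBelow (suc v) (just z) ∎
      where open ≤-Reasoning
    below-termwise r v<r j _ | tri≈ _ refl _ rewrite hole | ev | occBelow-< {suc v} {v} ≤-refl =
      subst (_≤ 1) (sym (+-identityʳ _)) (occBelow-≤1 (suc r) (just v))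
    below-termwise r v<r j _ | tri< j<b _ _ with A j in eA | B j in eB
    ... | nothing | nothing = z≤n
    ... | nothing | just z = subst (_≤ occBelow (suc v) (just z)) (sym (+-identityʳ _))
                               (≤-trans (occBelow-≤1 (suc r) (just z)) (below-pos-left-of-hole j z (<⇒≤ j<b) eB))
    ... | just x | _ with below-left-of-hole j x j<b eA
    ...   | z , ez , _ rewrite trans (sym eB) ez = subst (_≤ occBelow r (just x) + occBelow (suc v) (just z)) (+-comm (occBelow v (just x)) _)
            (+-mono-≤ (occBelow-monoˡ (just x) (<⇒≤ v<r)) (≤-trans (occBelow-≤1 (suc r) (just z)) (below-pos-left-of-hole j z (<⇒≤ j<b) ez)))

    below-inequality : ∀ r → v < r →
      rowCountBelow G (suc a) (suc r) + rowCountBelow G a v ≤ rowCountBelow G a r + rowCountBelow G (suc a) (suc v)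
    below-inequality r v<r = subst₂ _≤_
      (trans (Σ<-+ (λ j → occBelow (suc r) (B j)) (λ j → occBelow v (A j)) H) (cong (_+ rowCountBelow G a v) (sym (rowCountBelow-lower (suc r)))))
      (trans (Σ<-+ (λ j → occBelow r (A j)) (λ j → occBelow (suc v) (B j)) H) (cong (rowCountBelow G a r +_) (sym (rowCountBelow-lower (suc v)))))
      (Σ<-mono-≤ H (below-termwise r v<r))

    excess-termwise : ∀ j → j < H →
      occBelow (inner a) (just j) + occBelow v (A j) ≤ occBelow (inner (suc a)) (just j) + occBelow (suc v) (B j)
    excess-termwise j _ with <-cmp j b
    ... | tri> _ _ b<j rewrite none-below-right-of-hole v j b<j ≤-refl | occBelow-≥ {inner a} {j} (≤-trans hole-inner (<⇒≤ b<j)) = z≤n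
    ... | tri≈ _ refl _ rewrite hole | occBelow-≥ {inner a} {j} hole-inner = z≤n
    ... | tri< j<b _ _ = ≤-trans at-most-one at-least-one
      where
        at-most-one : occBelow (inner a) (just j) + occBelow v (A j) ≤ 1
        at-most-one with j <? inner a
        ... | yes j<inner rewrite empty-inner a j ≤-refl j<inner = subst (_≤ 1) (sym (+-identityʳ _)) (occBelow-≤1 (inner a) (just j))
        ... | no j≮inner rewrite occBelow-≥ {inner a} {j} (≮⇒≥ j≮inner) = occBelow-≤1 v (A j)
        at-least-one : 1 ≤ occBelow (inner (suc a)) (just j) + occBelow (suc v) (B j)
        at-least-one with j <? inner (suc a)
        ... | yes j<inner = ≤-trans (occBelow-pos (just j) refl j<inner) (m≤m+n _ _)
        ... | no j≮inner with filled (suc a) j (n≤1+n a) (≮⇒≥ j≮inner) (<-trans j<b b<outer-below) (⊥-elim ∘ n≢1+n a ∘ sym)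
        ...   | z , ez rewrite ez = ≤-trans (below-pos-left-of-hole j z (<⇒≤ j<b) ez) (m≤n+m _ _)

    excess : inner a + rowCountBelow G a v < inner (suc a) + rowCountBelow G (suc a) (suc v)
    excess = subst₂ _<_
      (trans (Σ<-+ (λ j → occBelow (inner a) (just j)) (λ j → occBelow v (A j)) H)
             (cong (_+ rowCountBelow G a v) (Σ<-occBelow-index (inner a) H inner≤H)))
      (trans (Σ<-+ (λ j → occBelow (inner (suc a)) (just j)) (λ j → occBelow (suc v) (B j)) H)
             (cong₂ _+_ (Σ<-occBelow-index (inner (suc a)) H (≤-trans (inner-antitone a) inner≤H)) (sym (rowCountBelow-lower (suc v)))))
      (Σ<-mono-< H b excess-termwise b<outer at-hole)
      where
        inner≤H = ≤-trans hole-inner (<⇒≤ b<outer)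
        at-hole : occBelow (inner a) (just b) + occBelow v (A b) < occBelow (inner (suc a)) (just b) + occBelow (suc v) (B b)
        at-hole rewrite hole | ev | occBelow-≥ {inner a} {b} hole-inner | occBelow-< {suc v} {v} ≤-refl = m≤n+m 1 _

    G₁ = move G a b (suc a) b v

    G₁-hole : G₁ a b ≡ just v
    G₁-hole = move-target G a b (suc a) b v (n≢1+n a ∘ proj₁)

    G₁-vacated : G₁ (suc a) b ≡ nothing
    G₁-vacated = move-source G a b (suc a) b v

    G₁-row-a : ∀ j → ¬ j ≡ b → G₁ a j ≡ G a j
    G₁-row-a j j≢b = move-other G a b (suc a) b v a j (j≢b ∘ proj₂) (n≢1+n a ∘ proj₁)

    G₁-lower : ∀ i j → suc a ≤ i → ¬ (i ≡ suc a × j ≡ b) → G₁ i j ≡ G i j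
    G₁-lower i j a<i = move-other G a b (suc a) b v i j (λ { (i≡a , _) → <-irrefl (sym i≡a) a<i })

    G₁-other-row : ∀ i j → ¬ i ≡ a → ¬ i ≡ suc a → G₁ i j ≡ G i j
    G₁-other-row i j i≢a i≢a+1 = move-other G a b (suc a) b v i j (i≢a ∘ proj₁) (i≢a+1 ∘ proj₁)

    G₁-lower-just : ∀ i j x → suc a ≤ i → G₁ i j ≡ just x → G i j ≡ just x
    G₁-lower-just i j x a<i e with i ≟ suc a | j ≟ b
    ... | yes refl | yes refl = ⊥-elim (nothing≢just (trans (sym G₁-vacated) e))
    ... | yes _    | no j≢b   = trans (sym (G₁-lower i j a<i (j≢b ∘ proj₂))) e
    ... | no i≢    | _        = trans (sym (G₁-lower i j a<i (i≢ ∘ proj₁))) e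

    G₁-lower-nothing : ∀ i j → suc a ≤ i → G i j ≡ nothing → G₁ i j ≡ nothing
    G₁-lower-nothing i j a<i e with i ≟ suc a | j ≟ b
    ... | yes refl | yes refl = G₁-vacated
    ... | yes _    | no j≢b   = trans (G₁-lower i j a<i (j≢b ∘ proj₂)) e
    ... | no i≢    | _        = trans (G₁-lower i j a<i (i≢ ∘ proj₁)) e

    rowCount-a : ∀ s → rowCount G₁ a s ≡ rowCount G a s + occ s (just v)
    rowCount-a s = begin
      rowCount G₁ a s                    ≡⟨ sym (+-identityʳ _) ⟩
      rowCount G₁ a s + 0                ≡⟨ cong (λ m → rowCount G₁ a s + occ s m) (sym hole) ⟩
      rowCount G₁ a s + occ s (G a b)    ≡⟨ rowCount-update G G₁ a b s b<outer G₁-row-a ⟩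
      rowCount G a s + occ s (G₁ a b)    ≡⟨ cong (λ m → rowCount G a s + occ s m) G₁-hole ⟩
      rowCount G a s + occ s (just v)    ∎
      where open ≡-Reasoning

    rowCount-a+1 : ∀ s → rowCount G₁ (suc a) s + occ s (just v) ≡ rowCount G (suc a) s
    rowCount-a+1 s = begin
      rowCount G₁ (suc a) s + occ s (just v)       ≡⟨ cong (λ m → rowCount G₁ (suc a) s + occ s m) (sym ev) ⟩
      rowCount G₁ (suc a) s + occ s (G (suc a) b)  ≡⟨ rowCount-update G G₁ (suc a) b s b<outer-below
                                                        (λ j j≢b → G₁-lower (suc a) j ≤-refl (j≢b ∘ proj₂)) ⟩
      rowCount G (suc a) s + occ s (G₁ (suc a) b)  ≡⟨ cong (λ m → rowCount G (suc a) s + occ s m) G₁-vacated ⟩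
      rowCount G (suc a) s + 0                     ≡⟨ +-identityʳ _ ⟩
      rowCount G (suc a) s                         ∎
      where open ≡-Reasoning

    rowCount-other : ∀ i s → ¬ i ≡ a → ¬ i ≡ suc a → rowCount G₁ i s ≡ rowCount G i s
    rowCount-other i s i≢a i≢a+1 = Σ<-cong (outer i) (λ j _ → cong (occ s) (G₁-other-row i j i≢a i≢a+1))

    down-step : ∀ {Ts'} → (∀ i s → rowCount G₁ i s ≡ count i (row Ts' s)) → Midslide G₁ (suc a) b Ts'
    down-step companion₁ = record
      { hole          = G₁-vacated
      ; hole-inner    = proj₁ (entry-bounds I (suc a) b v (n≤1+n a) ev)
      ; empty-inner   = λ i j a<i j< → G₁-lower-nothing i j a<i (empty-inner i j (≤-trans (n≤1+n a) a<i) j<)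
      ; empty-outer   = λ i j a<i ≤j → G₁-lower-nothing i j a<i (empty-outer i j (≤-trans (n≤1+n a) a<i) ≤j)
      ; filled        = filled₁
      ; row-sorted    = λ i j j' x x' a<i j≤j' e e' →
                          row-sorted i j j' x x' (≤-trans (n≤1+n a) a<i) j≤j' (G₁-lower-just i j x a<i e) (G₁-lower-just i j' x' a<i e')
      ; column-strict = λ i j x x' a<i e e' →
                          column-strict i j x x' (≤-trans (n≤1+n a) a<i) (G₁-lower-just i j x a<i e)
                            (G₁-lower-just (suc i) j x' (≤-trans a<i (n≤1+n i)) e')
      ; companion     = companion₁
      }
      where
        filled₁ : ∀ i j → suc a ≤ i → inner i ≤ j → j < outer i → (i ≡ suc a → ¬ j ≡ b) → Σ ℕ λ x → G₁ i j ≡ just x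
        filled₁ i j a<i inner≤j j<outer not-hole with filled i j (≤-trans (n≤1+n a) a<i) inner≤j j<outer (λ i≡a → ⊥-elim (<-irrefl (sym i≡a) a<i))
        ... | x , ex = x , trans (G₁-lower i j a<i (λ { (i≡ , j≡) → not-hole i≡ j≡ })) ex

-- Shapes and κ-dominance

remove-square-⊆ : ∀ α' α k → part α' k + 1 ≡ part α k → (∀ i → ¬ i ≡ k → part α' i ≡ part α i) → α' ⊆ₚ α
remove-square-⊆ α' α k last rest i with i ≟ k
... | yes refl = subst (_ ≤_) last (m≤m+n _ 1)
... | no i≢k   = ≤-reflexive (rest i i≢k)

dominant-from-counts : ∀ κ Ts → (∀ j r → part κ (suc j) + countAbove Ts (suc j) (suc r) ≤ part κ j + countAbove Ts j r) →
                       KappaDominant κ Ts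
dominant-from-counts κ Ts h u v eq j with semitic-prefix-row Ts u v (sym eq)
... | r , bounds = begin
  part κ (suc j) + count (suc j) u                ≤⟨ +-monoʳ-≤ (part κ (suc j)) (proj₂ (bounds (suc j))) ⟩
  part κ (suc j) + countAbove Ts (suc j) (suc r)  ≤⟨ h j r ⟩
  part κ j + countAbove Ts j r                    ≤⟨ +-monoʳ-≤ (part κ j) (proj₁ (bounds j)) ⟩
  part κ j + count j u                            ∎
  where open ≤-Reasoning

countLess : Tableau → ℕ → ℕ → ℕ
countLess S i r = Σ< (λ s → count s (row S i)) r

-- each square of row j + 1 that lies in κ or holds an entry ≤ r lies below a square of row j
-- that lies in κ or, by column strictness, holds an entry < r
countLess-lattice : ∀ ν κ S (shape : SkewShape ν κ) → Tab ν κ S → ∀ j r →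
                    part κ (suc j) + countLess S (suc j) (suc r) ≤ part κ j + countLess S j r
countLess-lattice ν κ S shape tab j r = begin
  part κ (suc j) + countLess S (suc j) (suc r)
    ≡⟨ cong₂ _+_ (sym (Σ<-occBelow-index (part κ (suc j)) H (≤-trans (κ-antitone j) (κ⊆ν j)))) (countLess-grid (suc j) (suc r) (ν-antitone j)) ⟩
  Σ< (λ c → occBelow (part κ (suc j)) (just c)) H + Σ< (λ c → occBelow (suc r) (grid κ S (suc j) c)) H
    ≡⟨ sym (Σ<-+ _ _ H) ⟩
  Σ< (λ c → occBelow (part κ (suc j)) (just c) + occBelow (suc r) (grid κ S (suc j) c)) H
    ≤⟨ Σ<-mono-≤ H termwise ⟩
  Σ< (λ c → occBelow (part κ j) (just c) + occBelow r (grid κ S j c)) H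
    ≡⟨ Σ<-+ _ _ H ⟩
  Σ< (λ c → occBelow (part κ j) (just c)) H + Σ< (λ c → occBelow r (grid κ S j c)) H
    ≡⟨ cong₂ _+_ (Σ<-occBelow-index (part κ j) H (κ⊆ν j)) (sym (countLess-grid j r ≤-refl)) ⟩
  part κ j + countLess S j r ∎
  where
    open ≤-Reasoning
    open TableauRows ν κ S shape tab
    ν-antitone = proj₁ shape
    κ-antitone = proj₁ (proj₂ shape)
    κ⊆ν = proj₂ (proj₂ shape)
    H = part ν j
    countLess-grid : ∀ i r → part ν i ≤ H → countLess S i r ≡ Σ< (λ c → occBelow r (grid κ S i c)) H
    countLess-grid i r ν≤H = begin-equality
      countLess S i r                                        ≡⟨ Σ<-cong r (λ s _ → sym (Σ<-occ-grid s i H ν≤H)) ⟩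
      Σ< (λ s → Σ< (λ c → occ s (grid κ S i c)) H) r         ≡⟨ Σ<-swap (λ s c → occ s (grid κ S i c)) r H ⟩
      Σ< (λ c → Σ< (λ s → occ s (grid κ S i c)) r) H         ≡⟨ Σ<-cong H (λ c _ → Σ<-occ (grid κ S i c) r) ⟩
      Σ< (λ c → occBelow r (grid κ S i c)) H                 ∎
    termwise : ∀ c → c < H → occBelow (part κ (suc j)) (just c) + occBelow (suc r) (grid κ S (suc j) c)
                                ≤ occBelow (part κ j) (just c) + occBelow r (grid κ S j c)
    termwise c _ with grid κ S (suc j) c in eB
    ... | nothing = ≤-trans (≤-reflexive (+-identityʳ _)) (≤-trans (occBelow-monoˡ (just c) (κ-antitone j)) (m≤m+n _ _))
    ... | just z rewrite occBelow-≥ {part κ (suc j)} {c} (proj₁ (rowGrid-bounds (part κ (suc j)) (row S (suc j)) c eB)) with c <? part κ j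
    ...   | yes c<κ = ≤-trans (occBelow-≤1 (suc r) (just z)) (≤-trans (occBelow-pos (just c) refl c<κ) (m≤m+n _ _))
    ...   | no c≮κ with rowGrid-filled (part κ j) (row S j) c (≮⇒≥ c≮κ)
                         (subst (c <_) (sym (row-end j))
                           (<-≤-trans (subst (c <_) (row-end (suc j)) (proj₂ (rowGrid-bounds (part κ (suc j)) (row S (suc j)) c eB))) (ν-antitone j)))
    ...     | x , ex rewrite ex = ≤-trans (occBelow-transfer (λ z<r+1 → <-≤-trans (proj₂ (proj₂ tab) j c x z ex eB) (≤-pred z<r+1))) (m≤n+m _ _)

companion-dominant : ∀ ν κ S Ts → SkewShape ν κ → Tab ν κ S → Companion Ts S → KappaDominant κ Ts
companion-dominant ν κ S Ts shape tab companion = dominant-from-counts κ Ts λ j r →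
  subst₂ (λ p q → part κ (suc j) + p ≤ part κ j + q)
    (Σ<-cong (suc r) (λ s _ → companion (suc j) s)) (Σ<-cong r (λ s _ → companion j s))
    (countLess-lattice ν κ S shape tab j r)

-- A slide, followed on the companion tableau

module SlideCompanion (χλ χμ : List ℕ) (χ : SkewShape χλ χμ) (κ' ν : List ℕ) (κ'-partition : IsPartition κ') (ν-partition : IsPartition ν) where
  open Sliding (part κ') (part ν) κ'-partition ν-partition

  DownMoveResult : Grid → ℕ → ℕ → Tableau → ℕ → Set
  DownMoveResult G a b Ts v = Σ Tableau λ Ts' →
    RaiseTab a Ts Ts' × Midslide (move G a b (suc a) b v) (suc a) b Ts' × Tab χλ χμ Ts' × ¬ KappaDominant κ' Ts

  module DownRaise (Top Bot : Tableau) (L R : List ℕ) (a : ℕ) (L<a+1 : All (_< suc a) L) (a+1≤R : All (suc a ≤_) R) where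
    open RaiseFirst Top Bot L R a L<a+1 a+1≤R
    open Semistandard χλ χμ χ

    -- the entry moving up from row a + 1 is y itself, so in the companion row y trades an a + 1 for an a
    module _ {G b} (I : Midslide G a b T₀) (ev : G (suc a) b ≡ just y)
             (beside : G a (suc b) ≡ nothing ⊎ Σ ℕ (λ x → G a (suc b) ≡ just x × y ≤ x)) where
      open DownMove I ev beside

      to-counts : ∀ i r → rowCountBelow G i r ≡ countAbove T₀ i r
      to-counts i r = sym (countAbove≡rowCountBelow G T₀ (Midslide.companion I) i r)

      above : AboveCondition
      above r r<y = subst₂ _≤_ (cong₂ (λ p q → p + q + 1) (to-counts a y) (to-counts (suc a) (suc r)))
                               (cong₂ _+_ (to-counts (suc a) (suc y)) (to-counts a r)) (above-inequality r r<y)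

      below : BelowCondition
      below n = subst₂ _≤_ (cong₂ _+_ (trans (to-counts (suc a) (suc (y + suc n))) (cong (countAbove T₀ (suc a)) (sym (+-suc y (suc n)))))
                                      (to-counts a y))
                           (cong₂ _+_ (to-counts a (y + suc n)) (to-counts (suc a) (suc y)))
                           (below-inequality (y + suc n) (m<m+n y (s≤s z≤n)))

      before-not-dominant : ¬ KappaDominant κ' T₀
      before-not-dominant = not-dominant κ' (subst₂ (λ p q → part κ' a + p < part κ' (suc a) + q) (to-counts a y) (to-counts (suc a) (suc y)) excess)

      row-y : ∀ i → rowCount G i y ≡ count i Y
      row-y i = trans (Midslide.companion I i y) (cong (count i) row-T₀-y)

      companion-other-row : ∀ i s → ¬ s ≡ y → rowCount G₁ i s ≡ count i (row T₁ s)
      companion-other-row i s s≢y rewrite row-T₁-≢ s s≢y with i ≟ a | i ≟ suc a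
      ... | yes refl | _ = trans (rowCount-a s) (trans (cong (rowCount G a s +_) (occ-≢ s≢y))
                             (trans (+-identityʳ _) (Midslide.companion I a s)))
      ... | no _ | yes refl = trans (sym (+-identityʳ _)) (trans (cong (rowCount G₁ (suc a) s +_) (sym (occ-≢ s≢y)))
                                (trans (rowCount-a+1 s) (Midslide.companion I (suc a) s)))
      ... | no i≢a | no i≢a+1 = trans (rowCount-other i s i≢a i≢a+1) (Midslide.companion I i s)

      companion-raised-row : ∀ i → rowCount G₁ i y ≡ count i (L ++ a ∷ R)
      companion-raised-row i with i ≟ a | i ≟ suc a
      ... | yes refl | _ = begin
        rowCount G₁ a y                            ≡⟨ rowCount-a y ⟩
        rowCount G a y + occ y (just y)            ≡⟨ cong₂ _+_ (row-y a) (occ-self y) ⟩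
        count a Y + 1                              ≡⟨ cong (count a Y +_) (sym (occ-self a)) ⟩
        count a Y + occ a (just a)                 ≡⟨ sym (count-lowered a) ⟩
        count a (L ++ a ∷ R) + occ a (just (suc a)) ≡⟨ cong (count a (L ++ a ∷ R) +_) (occ-≢ {a} (n≢1+n a)) ⟩
        count a (L ++ a ∷ R) + 0                   ≡⟨ +-identityʳ _ ⟩
        count a (L ++ a ∷ R)                       ∎
        where open ≡-Reasoning
      ... | no _ | yes refl = +-cancelʳ-≡ 1 _ _ (begin
        rowCount G₁ (suc a) y + 1                  ≡⟨ cong (rowCount G₁ (suc a) y +_) (sym (occ-self y)) ⟩
        rowCount G₁ (suc a) y + occ y (just y)     ≡⟨ rowCount-a+1 y ⟩
        rowCount G (suc a) y                       ≡⟨ row-y (suc a) ⟩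
        count (suc a) Y                            ≡⟨ sym (+-identityʳ _) ⟩
        count (suc a) Y + 0                        ≡⟨ cong (count (suc a) Y +_) (sym (occ-≢ {suc a} (1+n≢n))) ⟩
        count (suc a) Y + occ (suc a) (just a)     ≡⟨ sym (count-lowered (suc a)) ⟩
        count (suc a) (L ++ a ∷ R) + occ (suc a) (just (suc a)) ≡⟨ cong (count (suc a) (L ++ a ∷ R) +_) (occ-self (suc a)) ⟩
        count (suc a) (L ++ a ∷ R) + 1             ∎)
        where open ≡-Reasoning
      ... | no i≢a | no i≢a+1 = begin
        rowCount G₁ i y                            ≡⟨ rowCount-other i y i≢a i≢a+1 ⟩
        rowCount G i y                             ≡⟨ row-y i ⟩
        count i Y                                  ≡⟨ sym (+-identityʳ _) ⟩
        count i Y + 0                              ≡⟨ cong (count i Y +_) (sym (occ-≢ i≢a)) ⟩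
        count i Y + occ i (just a)                 ≡⟨ sym (count-lowered i) ⟩
        count i (L ++ a ∷ R) + occ i (just (suc a)) ≡⟨ cong (count i (L ++ a ∷ R) +_) (occ-≢ i≢a+1) ⟩
        count i (L ++ a ∷ R) + 0                   ≡⟨ +-identityʳ _ ⟩
        count i (L ++ a ∷ R)                       ∎
        where open ≡-Reasoning

      companion₁ : ∀ i s → rowCount G₁ i s ≡ count i (row T₁ s)
      companion₁ i s with s ≟ y
      ... | no s≢y = companion-other-row i s s≢y
      ... | yes refl = trans (companion-raised-row i) (cong (count i) (sym row-T₁-y))

      down-raise : Tab χλ χμ T₀ → DownMoveResult G a b T₀ y
      down-raise tab₀ = T₁ , raise above below , down-step companion₁ , tab₁ tab₀ above , before-not-dominant

  down-move : ∀ {G a b Ts v} → Midslide G a b Ts → Tab χλ χμ Ts → G (suc a) b ≡ just v →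
              (G a (suc b) ≡ nothing ⊎ Σ ℕ (λ x → G a (suc b) ≡ just x × v ≤ x)) → DownMoveResult G a b Ts v
  down-move {G} {a} {b} {Ts} {v} I tab ev beside
    with split-at-row Ts v (nonempty-row⇒< Ts v (count-pos⇒nonempty (suc a) (row Ts v) a+1-in-row-v))
       | first-occurrence (suc a) (row Ts v) (TableauRows.row-weaklyIncreasing χλ χμ Ts χ tab v) a+1-in-row-v
    where
      a+1-in-row-v : 0 < count (suc a) (row Ts v)
      a+1-in-row-v = subst (0 <_) (Midslide.companion I (suc a) v)
        (≤-trans (≤-reflexive (trans (sym (occ-self v)) (cong (occ v) (sym ev))))
                 (Σ<-term-≤ (λ j → occ v (G (suc a) j)) (part ν (suc a)) b (proj₂ (entry-bounds I (suc a) b v (n≤1+n a) ev))))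
  ... | Top , Bot , eT , refl | L , R , eY , L<a+1 , a+1≤R with trans eT (cong (λ Y → Top ++ Y ∷ Bot) eY)
  ...   | refl = DownRaise.down-raise Top Bot L R a L<a+1 a+1≤R I ev beside tab

  module Final (κ'⊆ν : κ' ⊆ₚ ν) (ν' : List ℕ) (T̄' : Tableau) (ν'-partition : IsPartition ν') (tab' : Tab ν' κ' T̄') where

    Outcome : ℕ → ℕ → Tableau → Set
    Outcome a l Ts = Σ Tableau λ Tl →
        Chain a l Ts Tl
      × (∀ i Ti → i ≤ l → Chain a i Ts Ti → Tab χλ χμ Ti)
      × Companion Tl T̄'
      × KappaDominant κ' Tl
      × (∀ i Ti → i < l → Chain a i Ts Ti → ¬ KappaDominant κ' Ti)

    slide-outcome : ∀ {G a b G' l c} → Slide G a b G' l c → ∀ {Ts} → Midslide G a b Ts → Tab χλ χμ Ts →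
                    (∀ i j → G' i j ≡ grid κ' T̄' i j) → part ν' l + 1 ≡ part ν l → c ≡ part ν' l →
                    (∀ i → ¬ i ≡ l → part ν' i ≡ part ν i) → Outcome a l Ts
    slide-outcome (stop {G} {a} _ _ final) {Ts} I tab final-grid ν'-last c≡ ν'-rest =
      Ts , done , (λ i Ti i≤a ch → subst (Tab χλ χμ) (sym (chain-trivial ch i≤a)) tab) ,
      companion , companion-dominant ν' κ' T̄' Ts shape' tab' companion , λ i Ti i<a ch → ⊥-elim (<⇒≱ i<a (chain-≤ ch))
      where
        ν'⊆ν : ν' ⊆ₚ ν
        ν'⊆ν = remove-square-⊆ ν' ν a ν'-last ν'-rest
        κ'⊆ν' : κ' ⊆ₚ ν'
        κ'⊆ν' i with i ≟ a
        ... | yes refl = subst (part κ' i ≤_) c≡ (Midslide.hole-inner I)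
        ... | no i≢a = subst (part κ' i ≤_) (sym (ν'-rest i i≢a)) (κ'⊆ν i)
        shape' : SkewShape ν' κ'
        shape' = ν'-partition , κ'-partition , κ'⊆ν'
        companion : Companion Ts T̄'
        companion i r = begin
          count r (row T̄' i)                                 ≡⟨ sym (TableauRows.Σ<-occ-grid ν' κ' T̄' shape' tab' r i (part ν i) (ν'⊆ν i)) ⟩
          Σ< (λ j → occ r (grid κ' T̄' i j)) (part ν i)       ≡⟨ Σ<-cong (part ν i) (λ j _ → cong (occ r) (trans (sym (final-grid i j)) (final i j))) ⟩
          rowCount G i r                                     ≡⟨ Midslide.companion I i r ⟩
          count i (row Ts r)                                 ∎
          where open ≡-Reasoning
    slide-outcome (right ex below rest) I tab final-grid ν'-last c≡ ν'-rest =
      slide-outcome rest (RightMove.right-step I ex below) tab final-grid ν'-last c≡ ν'-rest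
    slide-outcome (down ev beside rest) I tab final-grid ν'-last c≡ ν'-rest with down-move I tab ev beside
    ... | Ts' , raised , I' , tab'' , not-dom with slide-outcome rest I' tab'' final-grid ν'-last c≡ ν'-rest
    ...   | Tl , chain , tabs , companion , dominant , not-doms =
      Tl , step raised chain , chain-after-step (Tab χλ χμ) _≤_ raised (λ _ → tab) tabs ,
      companion , dominant , chain-after-step (¬_ ∘ KappaDominant κ') _<_ raised (λ _ → not-dom) not-doms

  slide-start : ∀ κ T̄ Ts k → SkewShape ν κ → Tab ν κ T̄ → Companion Ts T̄ →
                part κ' k + 1 ≡ part κ k → (∀ i → ¬ i ≡ k → part κ' i ≡ part κ i) → Midslide (grid κ T̄) k (part κ k ∸ 1) Ts
  slide-start κ T̄ Ts k shape tab companion κ'-last κ'-rest = record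
    { hole          = rowGrid-below (part κ k) (row T̄ k) b hole-in-κ
    ; hole-inner    = ≤-reflexive (sym b≡)
    ; empty-inner   = λ i j _ j< → rowGrid-below (part κ i) (row T̄ i) j (<-≤-trans j< (κ'⊆κ i))
    ; empty-outer   = λ i j _ ≤j → rowGrid-beyond (part κ i) (row T̄ i) j (subst (_≤ j) (sym (row-end i)) ≤j)
    ; filled        = λ i j _ κ'≤j j< not-hole → rowGrid-filled (part κ i) (row T̄ i) j (κ≤j i j κ'≤j not-hole) (subst (j <_) (sym (row-end i)) j<)
    ; row-sorted    = λ i j j' x x' _ → grid-sorted i j j' x x'
    ; column-strict = λ i j x x' _ → proj₂ (proj₂ tab) i j x x'
    ; companion     = λ i s → trans (Σ<-occ-grid s i (part ν i) ≤-refl) (companion i s)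
    }
    where
      open TableauRows ν κ T̄ shape tab
      b = part κ k ∸ 1
      b≡ : b ≡ part κ' k
      b≡ = trans (cong (_∸ 1) (sym κ'-last)) (m+n∸n≡m _ 1)
      hole-in-κ : b < part κ k
      hole-in-κ = subst₂ _<_ (sym b≡) κ'-last (m<m+n (part κ' k) (s≤s z≤n))
      κ'⊆κ : κ' ⊆ₚ κ
      κ'⊆κ = remove-square-⊆ κ' κ k κ'-last κ'-rest
      κ≤j : ∀ i j → part κ' i ≤ j → (i ≡ k → ¬ j ≡ b) → part κ i ≤ j
      κ≤j i j κ'≤j not-hole with i ≟ k
      ... | yes refl = subst (_≤ j) (trans (+-comm 1 (part κ' i)) κ'-last) (≤∧≢⇒< κ'≤j (λ e → not-hole refl (trans (sym e) (sym b≡))))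
      ... | no i≢k = subst (_≤ j) (κ'-rest i i≢k) κ'≤j

mainTheorem6 : (χλ χμ : List ℕ) → SkewShape χλ χμ →
    (T : Tableau) → Tab χλ χμ T →
    (ν κ : List ℕ) → IsPartition ν → IsPartition κ → κ ⊆ₚ ν →
    (T̄ : Tableau) → Tab ν κ T̄ → Companion T T̄ →
    (k : ℕ) (ν' κ' : List ℕ) → IsPartition κ' → IsPartition ν' →
    part κ' k + 1 ≡ part κ k → (∀ i → ¬ (i ≡ k) → part κ' i ≡ part κ i) →
    (T̄' : Tableau) → Tab ν' κ' T̄' →
    (l c : ℕ) → Slide (grid κ T̄) k (part κ k ∸ 1) (grid κ' T̄') l c →
    part ν' l + 1 ≡ part ν l → c ≡ part ν' l → (∀ i → ¬ (i ≡ l) → part ν' i ≡ part ν i) →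
    Σ Tableau λ Tl →
        Chain k l T Tl
      × (∀ i Ti → i ≤ l → Chain k i T Ti → Tab χλ χμ Ti)
      × Companion Tl T̄'
      × KappaDominant κ' Tl
      × (∀ i Ti → i < l → Chain k i T Ti → ¬ KappaDominant κ' Ti)
mainTheorem6 χλ χμ χ T tab ν κ ν-partition κ-partition κ⊆ν T̄ tab̄ companion k ν' κ' κ'-partition ν'-partition
             κ'-last κ'-rest T̄' tab̄' l c slide ν'-last c≡ ν'-rest =
  Final.slide-outcome κ'⊆ν ν' T̄' ν'-partition tab̄' slide
    (slide-start κ T̄ T k (ν-partition , κ-partition , κ⊆ν) tab̄ companion κ'-last κ'-rest) tab (λ _ _ → refl) ν'-last c≡ ν'-rest
  where
    open SlideCompanion χλ χμ χ κ' ν κ'-partition ν-partition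
    κ'⊆ν : κ' ⊆ₚ ν
    κ'⊆ν i = ≤-trans (remove-square-⊆ κ' κ k κ'-last κ'-rest i) (κ⊆ν i)
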